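{- (Fundamental lemma.) If $\Gamma\vdash_{\mathbf{KP}} t:A$ and $\sigma\in[\![\Gamma]\!]$, then $t\sigma\in[\![A]\!]$.
   Context: Formulas are built from propositional atoms and $\bot$ using $\to,\land,\lor$; $\neg B$ abbreviates $B\to\bot$. $\mathbf{KP}$-terms: $t,s,u ::= x \mid t\,s \mid \lambda x.t \mid \mathtt{efq}(t) \mid \langle t,s\rangle \mid \pi_i t \mid \mathtt{in}_i t \mid \mathtt{case}\ t\ [y.s_1]\ [y.s_2] \mid \mathtt{hop}(x.t,\ y.s_1,\ y.s_2)$ ($i\in\{1,2\}$), with $y$ bound in $s_1,s_2$ and $x$ bound in $t$ in $\mathtt{hop}$; substitutions $\sigma$ are finite maps from variables to terms, $t\sigma$ capture-avoiding substitution. $\Gamma\vdash_{\mathbf{KP}} t:A$ is derived by the standard natural-deduction rules of intuitionistic propositional logic (axiom for declared variables; $\lambda$ for $\to_I$; application for $\to_E$; pairs for $\land_I$; $\pi_i t:A_i$ from $t:A_1\land A_2$; $\mathtt{in}_i t:A_1\lor A_2$ from $t:A_i$; $\mathtt{case}\,t\,[y.s_1][y.s_2]:D$ from $\Gamma\vdash t:A_1\lor A_2$ and $\Gamma,y:A_i\vdash s_i:D$; $\mathtt{efq}(t):A$ from $t:\bot$) plus the Harrop rule: from $\Gamma,x:\neg B\vdash t:A_1\lor A_2$, $\Gamma,y:\neg B\to A_1\vdash s_1:D$, $\Gamma,y:\neg B\to A_2\vdash s_2:D$ infer $\Gamma\vdash\mathtt{hop}(x.t,y.s_1,y.s_2):D$.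 Weak head $\mathbf{IPC}$ contexts: $W::=\Box\mid W\,t\mid\pi_i W\mid\mathtt{case}\ W\ [y.s_1]\ [y.s_2]$; weak head $\mathbf{KP}$ contexts: $K::=\Box\mid K\,s\mid\pi_i K\mid\mathtt{case}\ K\ [y.s_1]\ [y.s_2]\mid\mathtt{hop}(x.K,\ y.s_1,\ y.s_2)$. Top-level reduction $\mapsto_{\mathbf{KP}}$: $(\lambda x.t)s\mapsto t\{x:=s\}$; $\pi_i\langle t_1,t_2\rangle\mapsto t_i$; $\mathtt{case}\,(\mathtt{in}_i t)\,[y.s_1][y.s_2]\mapsto s_i\{y:=t\}$; $\mathtt{hop}(x.\mathtt{in}_i t,y.s_1,y.s_2)\mapsto s_i\{y:=\lambda x.t\}$; $\mathtt{hop}(x.W\langle\mathtt{efq}(t)\rangle,y.s_1,y.s_2)\mapsto s_1\{y:=\lambda x.\mathtt{efq}(t)\}$; $\to_{\mathbf{KP}}$ is its closure under all term constructors. $\mathsf{SN}$ is the set of $\to_{\mathbf{KP}}$-strongly normalizing terms; a context is $\mathsf{SN}$ if all its terms are in $\mathsf{SN}$. $\to_{\mathsf{SN}}$: $K\langle r\rangle\to_{\mathsf{SN}}K\langle r'\rangle$ whenever $r\mapsto_{\mathbf{KP}}r'$ by one of the five rules, with $K$ (and $W$) $\mathsf{SN}$ contexts and all immediate subterms $t,s,s_1,s_2$ of the rule in $\mathsf{SN}$. $t\twoheadrightarrow_{\mathsf{SN}} s$ means $t\to_{\mathsf{SN}}^* s$ and $s\not\to_{\mathsf{SN}}$. For a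 set $T$ of $\to_{\mathsf{SN}}$-normal forms, $\overline{T}:=\{s\mid s\twoheadrightarrow_{\mathsf{SN}} t\in T\}$. $\mathsf{Ne}:=\{K\langle x\rangle\mid K\ \mathsf{SN}, x\text{ a variable}\}\cup\{W\langle\mathtt{efq}(t)\rangle\mid W,t\ \mathsf{SN}\}$. Denotations: $[\![p]\!]:=\mathsf{SN}$ for $p$ atomic or $\bot$; $[\![A\to B]\!]:=\overline{\{\lambda x.t\mid\forall s\in[\![A]\!],\ t\{x:=s\}\in[\![B]\!]\}}\cup\overline{\mathsf{Ne}}$; $[\![A_1\land A_2]\!]:=\overline{\{\langle t_1,t_2\rangle\mid t_i\in[\![A_i]\!]\}}\cup\overline{\mathsf{Ne}}$; $[\![A_1\lor A_2]\!]:=\overline{\{\mathtt{in}_i t\mid t\in[\![A_i]\!]\}}\cup\overline{\mathsf{Ne}}$. For a typing context $\Gamma$, $[\![\Gamma]\!]$ is the set of substitutions $\sigma$ with domain exactly the variables of $\Gamma$ such that $\sigma(x)\in[\![A]\!]$ whenever $(x:A)\in\Gamma$. -}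

module Defs where

open import Data.Nat using (ℕ; zero; suc)
open import Data.List using (List; []; _∷_)
open import Data.Product using (Σ; _×_; _,_; ∃)
open import Data.Sum using (_⊎_)
open import Data.Empty using (⊥)
open import Relation.Nullary using (¬_)
open import Relation.Binary.PropositionalEquality using (_≡_)
open import Relation.Binary.Construct.Closure.ReflexiveTransitive using (Star)

data Form : Set where
  atom : ℕ → Form
  ff   : Form
  _⇒_  : Form → Form → Form
  _∧_  : Form → Form → Form
  _∨_  : Form → Form → Form

infixr 5 _⇒_
infixr 6 _∨_
infixr 7 _∧_

¬F_ : Form → Form
¬F B = B ⇒ ff

-- KP-terms, with de Bruijn indices (variable 0 = innermost binder).
-- lam binds one variable; case binds one variable in each branch;
-- hop binds x (index 0) in its first argument and y (index 0) in the
-- second and third arguments.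

data Tm : Set where
  var  : ℕ → Tm
  _·_  : Tm → Tm → Tm
  lam  : Tm → Tm
  efq  : Tm → Tm
  ⟨_,_⟩ : Tm → Tm → Tm
  π₁ π₂ : Tm → Tm
  in₁ in₂ : Tm → Tm
  case : Tm → Tm → Tm → Tm
  hop  : Tm → Tm → Tm → Tm

infixl 9 _·_

ext : (ℕ → ℕ) → ℕ → ℕ
ext ρ zero    = zero
ext ρ (suc i) = suc (ρ i)

rename : (ℕ → ℕ) → Tm → Tm
rename ρ (var i)      = var (ρ i)
rename ρ (t · s)      = rename ρ t · rename ρ s
rename ρ (lam t)      = lam (rename (ext ρ) t)
rename ρ (efq t)      = efq (rename ρ t)
rename ρ ⟨ t , s ⟩    = ⟨ rename ρ t , rename ρ s ⟩
rename ρ (π₁ t)       = π₁ (rename ρ t)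
rename ρ (π₂ t)       = π₂ (rename ρ t)
rename ρ (in₁ t)      = in₁ (rename ρ t)
rename ρ (in₂ t)      = in₂ (rename ρ t)
rename ρ (case t s₁ s₂) = case (rename ρ t) (rename (ext ρ) s₁) (rename (ext ρ) s₂)
rename ρ (hop t s₁ s₂)  = hop (rename (ext ρ) t) (rename (ext ρ) s₁) (rename (ext ρ) s₂)

Subst : Set
Subst = ℕ → Tm

exts : Subst → Subst
exts σ zero    = var zero
exts σ (suc i) = rename suc (σ i)

sub : Subst → Tm → Tm
sub σ (var i)      = σ i
sub σ (t · s)      = sub σ t · sub σ s
sub σ (lam t)      = lam (sub (exts σ) t)
sub σ (efq t)      = efq (sub σ t)
sub σ ⟨ t , s ⟩    = ⟨ sub σ t , sub σ s ⟩
sub σ (π₁ t)       = π₁ (sub σ t)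
sub σ (π₂ t)       = π₂ (sub σ t)
sub σ (in₁ t)      = in₁ (sub σ t)
sub σ (in₂ t)      = in₂ (sub σ t)
sub σ (case t s₁ s₂) = case (sub σ t) (sub (exts σ) s₁) (sub (exts σ) s₂)
sub σ (hop t s₁ s₂)  = hop (sub (exts σ) t) (sub (exts σ) s₁) (sub (exts σ) s₂)

_[_] : Tm → Tm → Tm
t [ s ] = sub σ t
  where
  σ : Subst
  σ zero    = s
  σ (suc i) = var i

data _∋_∶_ : List Form → ℕ → Form → Set where
  here  : ∀ {Γ A} → (A ∷ Γ) ∋ zero ∶ A
  there : ∀ {Γ A B i} → Γ ∋ i ∶ A → (B ∷ Γ) ∋ suc i ∶ A

data _⊢_∶_ : List Form → Tm → Form → Set where
  ax   : ∀ {Γ i A} → Γ ∋ i ∶ A → Γ ⊢ var i ∶ A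
  ⇒I   : ∀ {Γ t A B} → (A ∷ Γ) ⊢ t ∶ B → Γ ⊢ lam t ∶ (A ⇒ B)
  ⇒E   : ∀ {Γ t s A B} → Γ ⊢ t ∶ (A ⇒ B) → Γ ⊢ s ∶ A → Γ ⊢ t · s ∶ B
  ∧I   : ∀ {Γ t s A B} → Γ ⊢ t ∶ A → Γ ⊢ s ∶ B → Γ ⊢ ⟨ t , s ⟩ ∶ (A ∧ B)
  ∧E₁  : ∀ {Γ t A B} → Γ ⊢ t ∶ (A ∧ B) → Γ ⊢ π₁ t ∶ A
  ∧E₂  : ∀ {Γ t A B} → Γ ⊢ t ∶ (A ∧ B) → Γ ⊢ π₂ t ∶ B
  ∨I₁  : ∀ {Γ t A B} → Γ ⊢ t ∶ A → Γ ⊢ in₁ t ∶ (A ∨ B)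
  ∨I₂  : ∀ {Γ t A B} → Γ ⊢ t ∶ B → Γ ⊢ in₂ t ∶ (A ∨ B)
  ∨E   : ∀ {Γ t s₁ s₂ A₁ A₂ D} → Γ ⊢ t ∶ (A₁ ∨ A₂) →
         (A₁ ∷ Γ) ⊢ s₁ ∶ D → (A₂ ∷ Γ) ⊢ s₂ ∶ D → Γ ⊢ case t s₁ s₂ ∶ D
  ⊥E   : ∀ {Γ t A} → Γ ⊢ t ∶ ff → Γ ⊢ efq t ∶ A
  harrop : ∀ {Γ t s₁ s₂ B A₁ A₂ D} → (¬F B ∷ Γ) ⊢ t ∶ (A₁ ∨ A₂) →
         ((¬F B ⇒ A₁) ∷ Γ) ⊢ s₁ ∶ D → ((¬F B ⇒ A₂) ∷ Γ) ⊢ s₂ ∶ D →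
         Γ ⊢ hop t s₁ s₂ ∶ D

data WCtx : Set where
  □     : WCtx
  _·W_  : WCtx → Tm → WCtx
  π₁W π₂W : WCtx → WCtx
  caseW : WCtx → Tm → Tm → WCtx

plugW : WCtx → Tm → Tm
plugW □ r = r
plugW (W ·W t) r = plugW W r · t
plugW (π₁W W) r = π₁ (plugW W r)
plugW (π₂W W) r = π₂ (plugW W r)
plugW (caseW W s₁ s₂) r = case (plugW W r) s₁ s₂

data KCtx : Set where
  □     : KCtx
  _·K_  : KCtx → Tm → KCtx
  π₁K π₂K : KCtx → KCtx
  caseK : KCtx → Tm → Tm → KCtx
  hopK  : KCtx → Tm → Tm → KCtx

-- plugging is literal (the hole may be under the binder x of hop)
plugK : KCtx → Tm → Tm
plugK □ r = r
plugK (K ·K t) r = plugK K r · t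
plugK (π₁K K) r = π₁ (plugK K r)
plugK (π₂K K) r = π₂ (plugK K r)
plugK (caseK K s₁ s₂) r = case (plugK K r) s₁ s₂
plugK (hopK K s₁ s₂) r = hop (plugK K r) s₁ s₂

data _↦_ : Tm → Tm → Set where
  β      : ∀ {t s} → (lam t · s) ↦ (t [ s ])
  π₁β    : ∀ {t₁ t₂} → π₁ ⟨ t₁ , t₂ ⟩ ↦ t₁
  π₂β    : ∀ {t₁ t₂} → π₂ ⟨ t₁ , t₂ ⟩ ↦ t₂
  case₁  : ∀ {t s₁ s₂} → case (in₁ t) s₁ s₂ ↦ (s₁ [ t ])
  case₂  : ∀ {t s₁ s₂} → case (in₂ t) s₁ s₂ ↦ (s₂ [ t ])
  hop₁   : ∀ {t s₁ s₂} → hop (in₁ t) s₁ s₂ ↦ (s₁ [ lam t ])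
  hop₂   : ∀ {t s₁ s₂} → hop (in₂ t) s₁ s₂ ↦ (s₂ [ lam t ])
  hopefq : ∀ {W t s₁ s₂} → hop (plugW W (efq t)) s₁ s₂ ↦ (s₁ [ lam (efq t) ])

data _⟶_ : Tm → Tm → Set where
  top   : ∀ {t t'} → t ↦ t' → t ⟶ t'
  ·₁    : ∀ {t t' s} → t ⟶ t' → (t · s) ⟶ (t' · s)
  ·₂    : ∀ {t s s'} → s ⟶ s' → (t · s) ⟶ (t · s')
  lam₁  : ∀ {t t'} → t ⟶ t' → lam t ⟶ lam t'
  efq₁  : ∀ {t t'} → t ⟶ t' → efq t ⟶ efq t'
  pair₁ : ∀ {t t' s} → t ⟶ t' → ⟨ t , s ⟩ ⟶ ⟨ t' , s ⟩
  pair₂ : ∀ {t s s'} → s ⟶ s' → ⟨ t , s ⟩ ⟶ ⟨ t , s' ⟩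
  π₁₁   : ∀ {t t'} → t ⟶ t' → π₁ t ⟶ π₁ t'
  π₂₁   : ∀ {t t'} → t ⟶ t' → π₂ t ⟶ π₂ t'
  in₁₁  : ∀ {t t'} → t ⟶ t' → in₁ t ⟶ in₁ t'
  in₂₁  : ∀ {t t'} → t ⟶ t' → in₂ t ⟶ in₂ t'
  case₁₁ : ∀ {t t' s₁ s₂} → t ⟶ t' → case t s₁ s₂ ⟶ case t' s₁ s₂
  case₂₁ : ∀ {t s₁ s₁' s₂} → s₁ ⟶ s₁' → case t s₁ s₂ ⟶ case t s₁' s₂
  case₃₁ : ∀ {t s₁ s₂ s₂'} → s₂ ⟶ s₂' → case t s₁ s₂ ⟶ case t s₁ s₂'
  hop₁₁ : ∀ {t t' s₁ s₂} → t ⟶ t' → hop t s₁ s₂ ⟶ hop t' s₁ s₂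
  hop₂₁ : ∀ {t s₁ s₁' s₂} → s₁ ⟶ s₁' → hop t s₁ s₂ ⟶ hop t s₁' s₂
  hop₃₁ : ∀ {t s₁ s₂ s₂'} → s₂ ⟶ s₂' → hop t s₁ s₂ ⟶ hop t s₁ s₂'

data SN (t : Tm) : Set where
  sn : (∀ {t'} → t ⟶ t' → SN t') → SN t

SNW : WCtx → Set
SNW □ = Data.Unit.⊤ where import Data.Unit
SNW (W ·W t) = SNW W × SN t
SNW (π₁W W) = SNW W
SNW (π₂W W) = SNW W
SNW (caseW W s₁ s₂) = SNW W × SN s₁ × SN s₂

SNK : KCtx → Set
SNK □ = Data.Unit.⊤ where import Data.Unit
SNK (K ·K t) = SNK K × SN t
SNK (π₁K K) = SNK K
SNK (π₂K K) = SNK K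
SNK (caseK K s₁ s₂) = SNK K × SN s₁ × SN s₂
SNK (hopK K s₁ s₂) = SNK K × SN s₁ × SN s₂

data _↦SN_ : Tm → Tm → Set where
  β      : ∀ {t s} → SN t → SN s → (lam t · s) ↦SN (t [ s ])
  π₁β    : ∀ {t₁ t₂} → SN t₁ → SN t₂ → π₁ ⟨ t₁ , t₂ ⟩ ↦SN t₁
  π₂β    : ∀ {t₁ t₂} → SN t₁ → SN t₂ → π₂ ⟨ t₁ , t₂ ⟩ ↦SN t₂
  case₁  : ∀ {t s₁ s₂} → SN t → SN s₁ → SN s₂ → case (in₁ t) s₁ s₂ ↦SN (s₁ [ t ])
  case₂  : ∀ {t s₁ s₂} → SN t → SN s₁ → SN s₂ → case (in₂ t) s₁ s₂ ↦SN (s₂ [ t ])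
  hop₁   : ∀ {t s₁ s₂} → SN t → SN s₁ → SN s₂ → hop (in₁ t) s₁ s₂ ↦SN (s₁ [ lam t ])
  hop₂   : ∀ {t s₁ s₂} → SN t → SN s₁ → SN s₂ → hop (in₂ t) s₁ s₂ ↦SN (s₂ [ lam t ])
  hopefq : ∀ {W t s₁ s₂} → SNW W → SN t → SN s₁ → SN s₂ →
           hop (plugW W (efq t)) s₁ s₂ ↦SN (s₁ [ lam (efq t) ])

data _→SN_ : Tm → Tm → Set where
  step : ∀ (K : KCtx) {r r'} → SNK K → r ↦SN r' → plugK K r →SN plugK K r'

SNNormal : Tm → Set
SNNormal s = ¬ (∃ λ s' → s →SN s')

_↠SN_ : Tm → Tm → Set
t ↠SN s = Star _→SN_ t s × SNNormal s

Bar : (Tm → Set) → Tm → Set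
Bar T s = ∃ λ t → (s ↠SN t) × T t

data Ne : Tm → Set where
  neVar : ∀ (K : KCtx) (x : ℕ) → SNK K → Ne (plugK K (var x))
  neEfq : ∀ (W : WCtx) (t : Tm) → SNW W → SN t → Ne (plugW W (efq t))

⟦_⟧ : Form → Tm → Set
⟦ atom p ⟧ = SN
⟦ ff ⟧     = SN
⟦ A ⇒ B ⟧ u = Bar (λ v → ∃ λ t → v ≡ lam t × (∀ s → ⟦ A ⟧ s → ⟦ B ⟧ (t [ s ]))) u
            ⊎ Bar Ne u
⟦ A₁ ∧ A₂ ⟧ u = Bar (λ v → ∃ λ t₁ → ∃ λ t₂ → v ≡ ⟨ t₁ , t₂ ⟩ × ⟦ A₁ ⟧ t₁ × ⟦ A₂ ⟧ t₂) u
            ⊎ Bar Ne u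
⟦ A₁ ∨ A₂ ⟧ u = (Bar (λ v → ∃ λ t → v ≡ in₁ t × ⟦ A₁ ⟧ t) u
              ⊎ Bar (λ v → ∃ λ t → v ≡ in₂ t × ⟦ A₂ ⟧ t) u)
            ⊎ Bar Ne u

⟦_⟧ctx : List Form → Subst → Set
⟦ Γ ⟧ctx σ = ∀ {i A} → Γ ∋ i ∶ A → ⟦ A ⟧ (σ i)

-- For the Harrop rule the body t of hop is analysed through
--    its instance at variable 0, a renaming of t: reflecting the →SN-normalisation of that
--    instance shows that t reduces to an injection or a neutral term, and determinism
--    transfers this normal form to every instance t [ s ] at a reducible s.

module Submission where

open import Defs
open import Data.Empty using (⊥; ⊥-elim)
open import Data.List using (_∷_)
open import Data.Maybe using (Maybe; just; nothing)
open import Data.Maybe.Properties using (just-injective)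
open import Data.Nat using (ℕ; zero; suc)
open import Data.Product using (Σ; ∃; _×_; _,_; proj₁; proj₂)
open import Data.Sum using (_⊎_; inj₁; inj₂)
open import Data.Unit using (tt)
open import Function using (_∘_)
open import Relation.Nullary using (¬_)
open import Relation.Binary.Construct.Closure.ReflexiveTransitive
  using (Star; ε; _◅_; _◅◅_; gmap; kleisliStar)
open import Relation.Binary.PropositionalEquality
  using (_≡_; refl; sym; trans; cong; cong₂; subst; subst₂; _≗_)

cong₃ : ∀ {A B C D : Set} (f : A → B → C → D) {a a' b b' c c'} →
        a ≡ a' → b ≡ b' → c ≡ c' → f a b c ≡ f a' b' c'
cong₃ f refl refl refl = refl

_•_ : Tm → Subst → Subst
(s • σ) zero    = s
(s • σ) (suc i) = σ i

infixr 5 _•_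

exts-cong : ∀ {σ τ} → σ ≗ τ → exts σ ≗ exts τ
exts-cong e zero    = refl
exts-cong e (suc i) = cong (rename suc) (e i)

sub-cong : ∀ {σ τ} → σ ≗ τ → ∀ t → sub σ t ≡ sub τ t
sub-cong e (var i)        = e i
sub-cong e (t · s)        = cong₂ _·_ (sub-cong e t) (sub-cong e s)
sub-cong e (lam t)        = cong lam (sub-cong (exts-cong e) t)
sub-cong e (efq t)        = cong efq (sub-cong e t)
sub-cong e ⟨ t , s ⟩      = cong₂ ⟨_,_⟩ (sub-cong e t) (sub-cong e s)
sub-cong e (π₁ t)         = cong π₁ (sub-cong e t)
sub-cong e (π₂ t)         = cong π₂ (sub-cong e t)
sub-cong e (in₁ t)        = cong in₁ (sub-cong e t)
sub-cong e (in₂ t)        = cong in₂ (sub-cong e t)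
sub-cong e (case t s₁ s₂) = cong₃ case (sub-cong e t) (sub-cong (exts-cong e) s₁) (sub-cong (exts-cong e) s₂)
sub-cong e (hop t s₁ s₂) =
  cong₃ hop (sub-cong (exts-cong e) t) (sub-cong (exts-cong e) s₁) (sub-cong (exts-cong e) s₂)

ren-sub     : ∀ ρ t → rename ρ t ≡ sub (var ∘ ρ) t
ren-sub-ext : ∀ ρ t → rename (ext ρ) t ≡ sub (exts (var ∘ ρ)) t

ren-sub ρ (var i)        = refl
ren-sub ρ (t · s)        = cong₂ _·_ (ren-sub ρ t) (ren-sub ρ s)
ren-sub ρ (lam t)        = cong lam (ren-sub-ext ρ t)
ren-sub ρ (efq t)        = cong efq (ren-sub ρ t)
ren-sub ρ ⟨ t , s ⟩      = cong₂ ⟨_,_⟩ (ren-sub ρ t) (ren-sub ρ s)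
ren-sub ρ (π₁ t)         = cong π₁ (ren-sub ρ t)
ren-sub ρ (π₂ t)         = cong π₂ (ren-sub ρ t)
ren-sub ρ (in₁ t)        = cong in₁ (ren-sub ρ t)
ren-sub ρ (in₂ t)        = cong in₂ (ren-sub ρ t)
ren-sub ρ (case t s₁ s₂) = cong₃ case (ren-sub ρ t) (ren-sub-ext ρ s₁) (ren-sub-ext ρ s₂)
ren-sub ρ (hop t s₁ s₂)  = cong₃ hop (ren-sub-ext ρ t) (ren-sub-ext ρ s₁) (ren-sub-ext ρ s₂)

ren-sub-ext ρ t = trans (ren-sub (ext ρ) t) (sub-cong (λ { zero → refl ; (suc i) → refl }) t)

sub-ren     : ∀ σ ρ t → sub σ (rename ρ t) ≡ sub (σ ∘ ρ) t
sub-ren-ext : ∀ σ ρ t → sub (exts σ) (rename (ext ρ) t) ≡ sub (exts (σ ∘ ρ)) t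

sub-ren σ ρ (var i)        = refl
sub-ren σ ρ (t · s)        = cong₂ _·_ (sub-ren σ ρ t) (sub-ren σ ρ s)
sub-ren σ ρ (lam t)        = cong lam (sub-ren-ext σ ρ t)
sub-ren σ ρ (efq t)        = cong efq (sub-ren σ ρ t)
sub-ren σ ρ ⟨ t , s ⟩      = cong₂ ⟨_,_⟩ (sub-ren σ ρ t) (sub-ren σ ρ s)
sub-ren σ ρ (π₁ t)         = cong π₁ (sub-ren σ ρ t)
sub-ren σ ρ (π₂ t)         = cong π₂ (sub-ren σ ρ t)
sub-ren σ ρ (in₁ t)        = cong in₁ (sub-ren σ ρ t)
sub-ren σ ρ (in₂ t)        = cong in₂ (sub-ren σ ρ t)
sub-ren σ ρ (case t s₁ s₂) = cong₃ case (sub-ren σ ρ t) (sub-ren-ext σ ρ s₁) (sub-ren-ext σ ρ s₂)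
sub-ren σ ρ (hop t s₁ s₂)  = cong₃ hop (sub-ren-ext σ ρ t) (sub-ren-ext σ ρ s₁) (sub-ren-ext σ ρ s₂)

sub-ren-ext σ ρ t = trans (sub-ren (exts σ) (ext ρ) t) (sub-cong (λ { zero → refl ; (suc i) → refl }) t)

ren-ren : ∀ ρ ρ' t → rename ρ (rename ρ' t) ≡ rename (ρ ∘ ρ') t
ren-ren ρ ρ' t =
  trans (ren-sub ρ (rename ρ' t)) (trans (sub-ren (var ∘ ρ) ρ' t) (sym (ren-sub (ρ ∘ ρ') t)))

ren-after-sub     : ∀ ρ σ t → rename ρ (sub σ t) ≡ sub (rename ρ ∘ σ) t
ren-after-sub-ext : ∀ ρ σ t → rename (ext ρ) (sub (exts σ) t) ≡ sub (exts (rename ρ ∘ σ)) t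

ren-after-sub ρ σ (var i)        = refl
ren-after-sub ρ σ (t · s)        = cong₂ _·_ (ren-after-sub ρ σ t) (ren-after-sub ρ σ s)
ren-after-sub ρ σ (lam t)        = cong lam (ren-after-sub-ext ρ σ t)
ren-after-sub ρ σ (efq t)        = cong efq (ren-after-sub ρ σ t)
ren-after-sub ρ σ ⟨ t , s ⟩      = cong₂ ⟨_,_⟩ (ren-after-sub ρ σ t) (ren-after-sub ρ σ s)
ren-after-sub ρ σ (π₁ t)         = cong π₁ (ren-after-sub ρ σ t)
ren-after-sub ρ σ (π₂ t)         = cong π₂ (ren-after-sub ρ σ t)
ren-after-sub ρ σ (in₁ t)        = cong in₁ (ren-after-sub ρ σ t)
ren-after-sub ρ σ (in₂ t)        = cong in₂ (ren-after-sub ρ σ t)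
ren-after-sub ρ σ (case t s₁ s₂) =
  cong₃ case (ren-after-sub ρ σ t) (ren-after-sub-ext ρ σ s₁) (ren-after-sub-ext ρ σ s₂)
ren-after-sub ρ σ (hop t s₁ s₂) =
  cong₃ hop (ren-after-sub-ext ρ σ t) (ren-after-sub-ext ρ σ s₁) (ren-after-sub-ext ρ σ s₂)

ren-after-sub-ext ρ σ t = trans (ren-after-sub (ext ρ) (exts σ) t) (sub-cong shift t)
  where
  shift : rename (ext ρ) ∘ exts σ ≗ exts (rename ρ ∘ σ)
  shift zero    = refl
  shift (suc i) = trans (ren-ren (ext ρ) suc (σ i)) (sym (ren-ren suc ρ (σ i)))

sub-sub     : ∀ σ τ t → sub σ (sub τ t) ≡ sub (sub σ ∘ τ) t
sub-sub-ext : ∀ σ τ t → sub (exts σ) (sub (exts τ) t) ≡ sub (exts (sub σ ∘ τ)) t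

sub-sub σ τ (var i)        = refl
sub-sub σ τ (t · s)        = cong₂ _·_ (sub-sub σ τ t) (sub-sub σ τ s)
sub-sub σ τ (lam t)        = cong lam (sub-sub-ext σ τ t)
sub-sub σ τ (efq t)        = cong efq (sub-sub σ τ t)
sub-sub σ τ ⟨ t , s ⟩      = cong₂ ⟨_,_⟩ (sub-sub σ τ t) (sub-sub σ τ s)
sub-sub σ τ (π₁ t)         = cong π₁ (sub-sub σ τ t)
sub-sub σ τ (π₂ t)         = cong π₂ (sub-sub σ τ t)
sub-sub σ τ (in₁ t)        = cong in₁ (sub-sub σ τ t)
sub-sub σ τ (in₂ t)        = cong in₂ (sub-sub σ τ t)
sub-sub σ τ (case t s₁ s₂) = cong₃ case (sub-sub σ τ t) (sub-sub-ext σ τ s₁) (sub-sub-ext σ τ s₂)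
sub-sub σ τ (hop t s₁ s₂)  = cong₃ hop (sub-sub-ext σ τ t) (sub-sub-ext σ τ s₁) (sub-sub-ext σ τ s₂)

sub-sub-ext σ τ t = trans (sub-sub (exts σ) (exts τ) t) (sub-cong shift t)
  where
  shift : sub (exts σ) ∘ exts τ ≗ exts (sub σ ∘ τ)
  shift zero    = refl
  shift (suc i) = trans (sub-ren (exts σ) suc (τ i)) (sym (ren-after-sub suc σ (τ i)))

sub-id     : ∀ t → sub var t ≡ t
sub-id-ext : ∀ t → sub (exts var) t ≡ t

sub-id (var i)        = refl
sub-id (t · s)        = cong₂ _·_ (sub-id t) (sub-id s)
sub-id (lam t)        = cong lam (sub-id-ext t)
sub-id (efq t)        = cong efq (sub-id t)
sub-id ⟨ t , s ⟩      = cong₂ ⟨_,_⟩ (sub-id t) (sub-id s)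
sub-id (π₁ t)         = cong π₁ (sub-id t)
sub-id (π₂ t)         = cong π₂ (sub-id t)
sub-id (in₁ t)        = cong in₁ (sub-id t)
sub-id (in₂ t)        = cong in₂ (sub-id t)
sub-id (case t s₁ s₂) = cong₃ case (sub-id t) (sub-id-ext s₁) (sub-id-ext s₂)
sub-id (hop t s₁ s₂)  = cong₃ hop (sub-id-ext t) (sub-id-ext s₁) (sub-id-ext s₂)

sub-id-ext t = trans (sub-cong (λ { zero → refl ; (suc i) → refl }) t) (sub-id t)

[]-def : ∀ t s → t [ s ] ≡ sub (s • var) t
[]-def t s = sub-cong (λ { zero → refl ; (suc i) → refl }) t

exts-[] : ∀ σ t s → (sub (exts σ) t) [ s ] ≡ sub (s • σ) t
exts-[] σ t s =
  trans ([]-def (sub (exts σ) t) s) (trans (sub-sub (s • var) (exts σ) t) (sub-cong pointwise t))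
  where
  pointwise : sub (s • var) ∘ exts σ ≗ s • σ
  pointwise zero    = refl
  pointwise (suc i) = trans (sub-ren (s • var) suc (σ i)) (sub-id (σ i))

sub-[] : ∀ τ t s → sub τ (t [ s ]) ≡ (sub (exts τ) t) [ sub τ s ]
sub-[] τ t s = trans (cong (sub τ) ([]-def t s)) (trans (sub-sub τ (s • var) t)
                 (trans (sub-cong pointwise t) (sym (exts-[] τ t (sub τ s)))))
  where
  pointwise : sub τ ∘ (s • var) ≗ sub τ s • τ
  pointwise zero    = refl
  pointwise (suc i) = refl

ren-[] : ∀ ρ t s → rename ρ (t [ s ]) ≡ (rename (ext ρ) t) [ rename ρ s ]
ren-[] ρ t s = trans (ren-sub ρ (t [ s ])) (trans (sub-[] (var ∘ ρ) t s)
                 (sym (cong₂ _[_] (ren-sub-ext ρ t) (ren-sub ρ s))))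

contract : ℕ → ℕ
contract zero    = zero
contract (suc i) = i

[var0] : ∀ t → t [ var 0 ] ≡ rename contract t
[var0] t =
  trans ([]-def t (var 0))
        (trans (sub-cong (λ { zero → refl ; (suc i) → refl }) t) (sym (ren-sub contract t)))

subW : Subst → WCtx → WCtx
subW τ □               = □
subW τ (W ·W t)        = subW τ W ·W sub τ t
subW τ (π₁W W)         = π₁W (subW τ W)
subW τ (π₂W W)         = π₂W (subW τ W)
subW τ (caseW W s₁ s₂) = caseW (subW τ W) (sub (exts τ) s₁) (sub (exts τ) s₂)

sub-plugW : ∀ τ W r → sub τ (plugW W r) ≡ plugW (subW τ W) (sub τ r)
sub-plugW τ □               r = refl
sub-plugW τ (W ·W t)        r = cong (_· sub τ t) (sub-plugW τ W r)
sub-plugW τ (π₁W W)         r = cong π₁ (sub-plugW τ W r)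
sub-plugW τ (π₂W W)         r = cong π₂ (sub-plugW τ W r)
sub-plugW τ (caseW W s₁ s₂) r = cong (λ u → case u (sub (exts τ) s₁) (sub (exts τ) s₂)) (sub-plugW τ W r)

↦-target : ∀ {r a b} → a ≡ b → r ↦ a → r ↦ b
↦-target refl ρ = ρ

sub-↦ : ∀ τ {t t'} → t ↦ t' → sub τ t ↦ sub τ t'
sub-↦ τ (β {t} {s})             = ↦-target (sym (sub-[] τ t s)) β
sub-↦ τ π₁β                     = π₁β
sub-↦ τ π₂β                     = π₂β
sub-↦ τ (case₁ {t} {s₁})        = ↦-target (sym (sub-[] τ s₁ t)) case₁
sub-↦ τ (case₂ {t} {s₂ = s₂})   = ↦-target (sym (sub-[] τ s₂ t)) case₂
sub-↦ τ (hop₁ {t} {s₁})         = ↦-target (sym (sub-[] τ s₁ (lam t))) hop₁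
sub-↦ τ (hop₂ {t} {s₂ = s₂})    = ↦-target (sym (sub-[] τ s₂ (lam t))) hop₂
sub-↦ τ (hopefq {W} {t} {s₁} {s₂}) =
  subst₂ (λ a c → hop a (sub (exts τ) s₁) (sub (exts τ) s₂) ↦ c)
    (sym (sub-plugW (exts τ) W (efq t))) (sym (sub-[] τ s₁ (lam (efq t)))) hopefq

sub-⟶ : ∀ τ {t t'} → t ⟶ t' → sub τ t ⟶ sub τ t'
sub-⟶ τ (top ρ)      = top (sub-↦ τ ρ)
sub-⟶ τ (·₁ st)      = ·₁ (sub-⟶ τ st)
sub-⟶ τ (·₂ st)      = ·₂ (sub-⟶ τ st)
sub-⟶ τ (lam₁ st)    = lam₁ (sub-⟶ (exts τ) st)
sub-⟶ τ (efq₁ st)    = efq₁ (sub-⟶ τ st)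
sub-⟶ τ (pair₁ st)   = pair₁ (sub-⟶ τ st)
sub-⟶ τ (pair₂ st)   = pair₂ (sub-⟶ τ st)
sub-⟶ τ (π₁₁ st)     = π₁₁ (sub-⟶ τ st)
sub-⟶ τ (π₂₁ st)     = π₂₁ (sub-⟶ τ st)
sub-⟶ τ (in₁₁ st)    = in₁₁ (sub-⟶ τ st)
sub-⟶ τ (in₂₁ st)    = in₂₁ (sub-⟶ τ st)
sub-⟶ τ (case₁₁ st)  = case₁₁ (sub-⟶ τ st)
sub-⟶ τ (case₂₁ st)  = case₂₁ (sub-⟶ (exts τ) st)
sub-⟶ τ (case₃₁ st)  = case₃₁ (sub-⟶ (exts τ) st)
sub-⟶ τ (hop₁₁ st)   = hop₁₁ (sub-⟶ (exts τ) st)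
sub-⟶ τ (hop₂₁ st)   = hop₂₁ (sub-⟶ (exts τ) st)
sub-⟶ τ (hop₃₁ st)   = hop₃₁ (sub-⟶ (exts τ) st)

ren-⟶ : ∀ ρ {t t'} → t ⟶ t' → rename ρ t ⟶ rename ρ t'
ren-⟶ ρ {t} {t'} st = subst₂ _⟶_ (sym (ren-sub ρ t)) (sym (ren-sub ρ t')) (sub-⟶ (var ∘ ρ) st)

_⟶*_ : Tm → Tm → Set
_⟶*_ = Star _⟶_

infix 4 _⟶*_

_⟶*ˢ_ : Subst → Subst → Set
σ ⟶*ˢ τ = ∀ i → σ i ⟶* τ i

exts-⟶*ˢ : ∀ {σ τ} → σ ⟶*ˢ τ → exts σ ⟶*ˢ exts τ
exts-⟶*ˢ e zero    = ε
exts-⟶*ˢ e (suc i) = gmap (rename suc) (ren-⟶ suc) (e i)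

sub-⟶*ˢ : ∀ {σ τ} → σ ⟶*ˢ τ → ∀ t → sub σ t ⟶* sub τ t
sub-⟶*ˢ e (var i)        = e i
sub-⟶*ˢ e (t · s)        = gmap (_· _) ·₁ (sub-⟶*ˢ e t) ◅◅ gmap (_ ·_) ·₂ (sub-⟶*ˢ e s)
sub-⟶*ˢ e (lam t)        = gmap lam lam₁ (sub-⟶*ˢ (exts-⟶*ˢ e) t)
sub-⟶*ˢ e (efq t)        = gmap efq efq₁ (sub-⟶*ˢ e t)
sub-⟶*ˢ e ⟨ t , s ⟩      = gmap ⟨_, _ ⟩ pair₁ (sub-⟶*ˢ e t) ◅◅ gmap ⟨ _ ,_⟩ pair₂ (sub-⟶*ˢ e s)
sub-⟶*ˢ e (π₁ t)         = gmap π₁ π₁₁ (sub-⟶*ˢ e t)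
sub-⟶*ˢ e (π₂ t)         = gmap π₂ π₂₁ (sub-⟶*ˢ e t)
sub-⟶*ˢ e (in₁ t)        = gmap in₁ in₁₁ (sub-⟶*ˢ e t)
sub-⟶*ˢ e (in₂ t)        = gmap in₂ in₂₁ (sub-⟶*ˢ e t)
sub-⟶*ˢ e (case t s₁ s₂) =
  gmap (λ u → case u _ _) case₁₁ (sub-⟶*ˢ e t) ◅◅
  gmap (λ u → case _ u _) case₂₁ (sub-⟶*ˢ (exts-⟶*ˢ e) s₁) ◅◅
  gmap (λ u → case _ _ u) case₃₁ (sub-⟶*ˢ (exts-⟶*ˢ e) s₂)
sub-⟶*ˢ e (hop t s₁ s₂)  =
  gmap (λ u → hop u _ _) hop₁₁ (sub-⟶*ˢ (exts-⟶*ˢ e) t) ◅◅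
  gmap (λ u → hop _ u _) hop₂₁ (sub-⟶*ˢ (exts-⟶*ˢ e) s₁) ◅◅
  gmap (λ u → hop _ _ u) hop₃₁ (sub-⟶*ˢ (exts-⟶*ˢ e) s₂)

[]-⟶-body : ∀ {t t'} s → t ⟶ t' → (t [ s ]) ⟶ (t' [ s ])
[]-⟶-body {t} {t'} s st = subst₂ _⟶_ (sym ([]-def t s)) (sym ([]-def t' s)) (sub-⟶ (s • var) st)

[]-⟶-arg : ∀ t {s s'} → s ⟶ s' → t [ s ] ⟶* t [ s' ]
[]-⟶-arg t {s} {s'} st = subst₂ _⟶*_ (sym ([]-def t s)) (sym ([]-def t s')) (sub-⟶*ˢ pointwise t)
  where
  pointwise : (s • var) ⟶*ˢ (s' • var)
  pointwise zero    = st ◅ ε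
  pointwise (suc i) = ε

[]-⟶*-arg : ∀ t {s s'} → s ⟶* s' → t [ s ] ⟶* t [ s' ]
[]-⟶*-arg t = kleisliStar (t [_]) ([]-⟶-arg t)

SN-⟶ : ∀ {t t'} → SN t → t ⟶ t' → SN t'
SN-⟶ (sn h) st = h st

SN-⟶* : ∀ {t t'} → SN t → t ⟶* t' → SN t'
SN-⟶* h ε          = h
SN-⟶* h (st ◅ sts) = SN-⟶* (SN-⟶ h st) sts

SN-inv : (f : Tm → Tm) → (∀ {a b} → a ⟶ b → f a ⟶ f b) → ∀ {t} → SN (f t) → SN t
SN-inv f f-⟶ (sn h) = sn λ st → SN-inv f f-⟶ (h (f-⟶ st))

SN-app-parts : ∀ {a s} → SN (a · s) → SN a × SN s
SN-app-parts h = SN-inv (_· _) ·₁ h , SN-inv (_ ·_) ·₂ h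

SN-case-parts : ∀ {a s₁ s₂} → SN (case a s₁ s₂) → SN a × SN s₁ × SN s₂
SN-case-parts h =
  SN-inv (λ u → case u _ _) case₁₁ h , SN-inv (λ u → case _ u _) case₂₁ h , SN-inv (λ u → case _ _ u) case₃₁ h

SN-hop-parts : ∀ {a s₁ s₂} → SN (hop a s₁ s₂) → SN a × SN s₁ × SN s₂
SN-hop-parts h =
  SN-inv (λ u → hop u _ _) hop₁₁ h , SN-inv (λ u → hop _ u _) hop₂₁ h , SN-inv (λ u → hop _ _ u) hop₃₁ h

SN-sub : ∀ τ {t} → SN (sub τ t) → SN t
SN-sub τ (sn h) = sn λ st → SN-sub τ (h (sub-⟶ τ st))

SN-ren : ∀ ρ {t} → SN (rename ρ t) → SN t
SN-ren ρ (sn h) = sn λ st → SN-ren ρ (h (ren-⟶ ρ st))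

SN-[] : ∀ {t} s → SN (t [ s ]) → SN t
SN-[] {t} s h = SN-sub (s • var) (subst SN ([]-def t s) h)

-- Shapes of weak heads.  A term is inert when it is neither an introduction form nor of
-- the form W⟨efq t⟩: plugging an inert term into a weak head context never creates a redex.

data Value : Tm → Set where
  v-lam  : ∀ {t} → Value (lam t)
  v-pair : ∀ {t s} → Value ⟨ t , s ⟩
  v-in₁  : ∀ {t} → Value (in₁ t)
  v-in₂  : ∀ {t} → Value (in₂ t)

efqHead : Tm → Maybe Tm
efqHead (efq t)      = just t
efqHead (t · _)      = efqHead t
efqHead (π₁ t)       = efqHead t
efqHead (π₂ t)       = efqHead t
efqHead (case t _ _) = efqHead t
efqHead _            = nothing

efqHead-plugW : ∀ W t → efqHead (plugW W (efq t)) ≡ just t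
efqHead-plugW □               t = refl
efqHead-plugW (W ·W _)        t = efqHead-plugW W t
efqHead-plugW (π₁W W)         t = efqHead-plugW W t
efqHead-plugW (π₂W W)         t = efqHead-plugW W t
efqHead-plugW (caseW W _ _)   t = efqHead-plugW W t

Inert : Tm → Set
Inert r = ¬ Value r × efqHead r ≡ nothing

inert-plugK : ∀ K {r} → Inert r → Inert (plugK K r)
inert-plugK □             i = i
inert-plugK (K ·K _)      i = (λ ()) , proj₂ (inert-plugK K i)
inert-plugK (π₁K K)       i = (λ ()) , proj₂ (inert-plugK K i)
inert-plugK (π₂K K)       i = (λ ()) , proj₂ (inert-plugK K i)
inert-plugK (caseK K _ _) i = (λ ()) , proj₂ (inert-plugK K i)
inert-plugK (hopK K _ _)  i = (λ ()) , refl

scrutinee : Tm → Tm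
scrutinee (t · _)      = t
scrutinee (π₁ t)       = t
scrutinee (π₂ t)       = t
scrutinee (case t _ _) = t
scrutinee (hop t _ _)  = t
scrutinee t            = t

redex-scrutinee : ∀ {r r'} → r ↦ r' → Inert (scrutinee r) → ⊥
redex-scrutinee β     (not-value , _) = not-value v-lam
redex-scrutinee π₁β   (not-value , _) = not-value v-pair
redex-scrutinee π₂β   (not-value , _) = not-value v-pair
redex-scrutinee case₁ (not-value , _) = not-value v-in₁
redex-scrutinee case₂ (not-value , _) = not-value v-in₂
redex-scrutinee hop₁  (not-value , _) = not-value v-in₁
redex-scrutinee hop₂  (not-value , _) = not-value v-in₂
redex-scrutinee (hopefq {W} {t}) (_ , e) with trans (sym (efqHead-plugW W t)) e
... | ()

-- Neutral terms, described structurally.  VarNe a says a = K⟨x⟩ and EfqNe t a says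
-- a = W⟨efq t⟩, in both cases with SN context and SN t; they are equivalent to Ne.

data VarNe : Tm → Set where
  var-ne  : ∀ {x} → VarNe (var x)
  app-ne  : ∀ {a s} → VarNe a → SN s → VarNe (a · s)
  π₁-ne   : ∀ {a} → VarNe a → VarNe (π₁ a)
  π₂-ne   : ∀ {a} → VarNe a → VarNe (π₂ a)
  case-ne : ∀ {a s₁ s₂} → VarNe a → SN s₁ → SN s₂ → VarNe (case a s₁ s₂)
  hop-ne  : ∀ {a s₁ s₂} → VarNe a → SN s₁ → SN s₂ → VarNe (hop a s₁ s₂)

data EfqNe (t : Tm) : Tm → Set where
  efq-ne  : SN t → EfqNe t (efq t)
  app-ne  : ∀ {a s} → EfqNe t a → SN s → EfqNe t (a · s)
  π₁-ne   : ∀ {a} → EfqNe t a → EfqNe t (π₁ a)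
  π₂-ne   : ∀ {a} → EfqNe t a → EfqNe t (π₂ a)
  case-ne : ∀ {a s₁ s₂} → EfqNe t a → SN s₁ → SN s₂ → EfqNe t (case a s₁ s₂)

Neutral : Tm → Set
Neutral a = VarNe a ⊎ ∃ λ t → EfqNe t a

varNe-inert : ∀ {a} → VarNe a → Inert a
varNe-inert var-ne              = (λ ()) , refl
varNe-inert (app-ne n _)        = (λ ()) , proj₂ (varNe-inert n)
varNe-inert (π₁-ne n)           = (λ ()) , proj₂ (varNe-inert n)
varNe-inert (π₂-ne n)           = (λ ()) , proj₂ (varNe-inert n)
varNe-inert (case-ne n _ _)     = (λ ()) , proj₂ (varNe-inert n)
varNe-inert (hop-ne n _ _)      = (λ ()) , refl

efqNe-head : ∀ {t a} → EfqNe t a → efqHead a ≡ just t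
efqNe-head (efq-ne _)       = refl
efqNe-head (app-ne e _)     = efqNe-head e
efqNe-head (π₁-ne e)        = efqNe-head e
efqNe-head (π₂-ne e)        = efqNe-head e
efqNe-head (case-ne e _ _)  = efqNe-head e

efqNe-SN : ∀ {t a} → EfqNe t a → SN t
efqNe-SN (efq-ne h)       = h
efqNe-SN (app-ne e _)     = efqNe-SN e
efqNe-SN (π₁-ne e)        = efqNe-SN e
efqNe-SN (π₂-ne e)        = efqNe-SN e
efqNe-SN (case-ne e _ _)  = efqNe-SN e

neutral-value : ∀ {v} → Neutral v → Value v → ⊥
neutral-value (inj₁ ()) v-lam
neutral-value (inj₁ ()) v-pair
neutral-value (inj₁ ()) v-in₁
neutral-value (inj₁ ()) v-in₂
neutral-value (inj₂ (_ , ())) v-lam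
neutral-value (inj₂ (_ , ())) v-pair
neutral-value (inj₂ (_ , ())) v-in₁
neutral-value (inj₂ (_ , ())) v-in₂

neutral-app : ∀ {a s} → Neutral a → SN s → Neutral (a · s)
neutral-app (inj₁ n)       h = inj₁ (app-ne n h)
neutral-app (inj₂ (t , e)) h = inj₂ (t , app-ne e h)

neutral-π₁ : ∀ {a} → Neutral a → Neutral (π₁ a)
neutral-π₁ (inj₁ n)       = inj₁ (π₁-ne n)
neutral-π₁ (inj₂ (t , e)) = inj₂ (t , π₁-ne e)

neutral-π₂ : ∀ {a} → Neutral a → Neutral (π₂ a)
neutral-π₂ (inj₁ n)       = inj₁ (π₂-ne n)
neutral-π₂ (inj₂ (t , e)) = inj₂ (t , π₂-ne e)

neutral-case : ∀ {a s₁ s₂} → Neutral a → SN s₁ → SN s₂ → Neutral (case a s₁ s₂)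
neutral-case (inj₁ n)       h₁ h₂ = inj₁ (case-ne n h₁ h₂)
neutral-case (inj₂ (t , e)) h₁ h₂ = inj₂ (t , case-ne e h₁ h₂)

varNe-plugK : ∀ K {x} → SNK K → VarNe (plugK K (var x))
varNe-plugK □               _              = var-ne
varNe-plugK (K ·K _)        (k , h)        = app-ne (varNe-plugK K k) h
varNe-plugK (π₁K K)         k              = π₁-ne (varNe-plugK K k)
varNe-plugK (π₂K K)         k              = π₂-ne (varNe-plugK K k)
varNe-plugK (caseK K _ _)   (k , h₁ , h₂)  = case-ne (varNe-plugK K k) h₁ h₂
varNe-plugK (hopK K _ _)    (k , h₁ , h₂)  = hop-ne (varNe-plugK K k) h₁ h₂

efqNe-plugW : ∀ W {t} → SNW W → SN t → EfqNe t (plugW W (efq t))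
efqNe-plugW □             _             h = efq-ne h
efqNe-plugW (W ·W _)      (w , h')      h = app-ne (efqNe-plugW W w h) h'
efqNe-plugW (π₁W W)       w             h = π₁-ne (efqNe-plugW W w h)
efqNe-plugW (π₂W W)       w             h = π₂-ne (efqNe-plugW W w h)
efqNe-plugW (caseW W _ _) (w , h₁ , h₂) h = case-ne (efqNe-plugW W w h) h₁ h₂

EfqContext : Tm → Tm → Set
EfqContext t a = Σ WCtx λ W → SNW W × a ≡ plugW W (efq t)

efqNe-context : ∀ {t a} → EfqNe t a → EfqContext t a
efqNe-context (efq-ne _) = □ , tt , refl
efqNe-context (app-ne e h) with efqNe-context e
... | W , w , refl = W ·W _ , (w , h) , refl
efqNe-context (π₁-ne e) with efqNe-context e
... | W , w , refl = π₁W W , w , refl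
efqNe-context (π₂-ne e) with efqNe-context e
... | W , w , refl = π₂W W , w , refl
efqNe-context (case-ne e h₁ h₂) with efqNe-context e
... | W , w , refl = caseW W _ _ , (w , h₁ , h₂) , refl

VarContext : Tm → Set
VarContext a = Σ KCtx λ K → Σ ℕ λ x → SNK K × a ≡ plugK K (var x)

varNe-context : ∀ {a} → VarNe a → VarContext a
varNe-context var-ne = □ , _ , tt , refl
varNe-context (app-ne n h) with varNe-context n
... | K , x , k , refl = K ·K _ , x , (k , h) , refl
varNe-context (π₁-ne n) with varNe-context n
... | K , x , k , refl = π₁K K , x , k , refl
varNe-context (π₂-ne n) with varNe-context n
... | K , x , k , refl = π₂K K , x , k , refl
varNe-context (case-ne n h₁ h₂) with varNe-context n
... | K , x , k , refl = caseK K _ _ , x , (k , h₁ , h₂) , refl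
varNe-context (hop-ne n h₁ h₂) with varNe-context n
... | K , x , k , refl = hopK K _ _ , x , (k , h₁ , h₂) , refl

Ne→neutral : ∀ {a} → Ne a → Neutral a
Ne→neutral (neVar K x k)   = inj₁ (varNe-plugK K k)
Ne→neutral (neEfq W t w h) = inj₂ (t , efqNe-plugW W w h)

neutral→Ne : ∀ {a} → Neutral a → Ne a
neutral→Ne (inj₁ n) with varNe-context n
... | K , x , k , refl = neVar K x k
neutral→Ne (inj₂ (t , e)) with efqNe-context e
... | W , w , refl = neEfq W t w (efqNe-SN e)

scrutinee-inert : ∀ {a} → VarNe a → Inert (scrutinee a)
scrutinee-inert var-ne            = (λ ()) , refl
scrutinee-inert (app-ne n _)      = varNe-inert n
scrutinee-inert (π₁-ne n)         = varNe-inert n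
scrutinee-inert (π₂-ne n)         = varNe-inert n
scrutinee-inert (case-ne n _ _)   = varNe-inert n
scrutinee-inert (hop-ne n _ _)    = varNe-inert n

-- A step of K⟨x⟩ never contracts a redex at the spine, since every redex on the spine
-- would eliminate an inert term; so it stays in the context.
varNe-⟶ : ∀ {a b} → VarNe a → a ⟶ b → VarNe b
varNe-⟶ n                 (top ρ)     = ⊥-elim (redex-scrutinee ρ (scrutinee-inert n))
varNe-⟶ (app-ne n h)      (·₁ st)     = app-ne (varNe-⟶ n st) h
varNe-⟶ (app-ne n h)      (·₂ st)     = app-ne n (SN-⟶ h st)
varNe-⟶ (π₁-ne n)         (π₁₁ st)    = π₁-ne (varNe-⟶ n st)
varNe-⟶ (π₂-ne n)         (π₂₁ st)    = π₂-ne (varNe-⟶ n st)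
varNe-⟶ (case-ne n h₁ h₂) (case₁₁ st) = case-ne (varNe-⟶ n st) h₁ h₂
varNe-⟶ (case-ne n h₁ h₂) (case₂₁ st) = case-ne n (SN-⟶ h₁ st) h₂
varNe-⟶ (case-ne n h₁ h₂) (case₃₁ st) = case-ne n h₁ (SN-⟶ h₂ st)
varNe-⟶ (hop-ne n h₁ h₂)  (hop₁₁ st)  = hop-ne (varNe-⟶ n st) h₁ h₂
varNe-⟶ (hop-ne n h₁ h₂)  (hop₂₁ st)  = hop-ne n (SN-⟶ h₁ st) h₂
varNe-⟶ (hop-ne n h₁ h₂)  (hop₃₁ st)  = hop-ne n h₁ (SN-⟶ h₂ st)

efqNe-⟶ : ∀ {t a b} → EfqNe t a → a ⟶ b → ∃ λ t' → EfqNe t' b × t ⟶* t'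
efqNe-⟶ (efq-ne h)        (efq₁ st)   = _ , efq-ne (SN-⟶ h st) , st ◅ ε
efqNe-⟶ (app-ne () _)     (top β)
efqNe-⟶ (app-ne e h)      (·₁ st)     = let t' , e' , r = efqNe-⟶ e st in t' , app-ne e' h , r
efqNe-⟶ (app-ne e h)      (·₂ st)     = _ , app-ne e (SN-⟶ h st) , ε
efqNe-⟶ (π₁-ne ())        (top π₁β)
efqNe-⟶ (π₁-ne e)         (π₁₁ st)    = let t' , e' , r = efqNe-⟶ e st in t' , π₁-ne e' , r
efqNe-⟶ (π₂-ne ())        (top π₂β)
efqNe-⟶ (π₂-ne e)         (π₂₁ st)    = let t' , e' , r = efqNe-⟶ e st in t' , π₂-ne e' , r
efqNe-⟶ (case-ne () _ _)  (top case₁)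
efqNe-⟶ (case-ne () _ _)  (top case₂)
efqNe-⟶ (case-ne e h₁ h₂) (case₁₁ st) = let t' , e' , r = efqNe-⟶ e st in t' , case-ne e' h₁ h₂ , r
efqNe-⟶ (case-ne e h₁ h₂) (case₂₁ st) = _ , case-ne e (SN-⟶ h₁ st) h₂ , ε
efqNe-⟶ (case-ne e h₁ h₂) (case₃₁ st) = _ , case-ne e h₁ (SN-⟶ h₂ st) , ε

neutral-⟶ : ∀ {a b} → Neutral a → a ⟶ b → Neutral b
neutral-⟶ (inj₁ n)       st = inj₁ (varNe-⟶ n st)
neutral-⟶ (inj₂ (_ , e)) st = inj₂ (_ , proj₁ (proj₂ (efqNe-⟶ e st)))

SN-var : ∀ {x} → SN (var x)
SN-var = sn λ { (top ()) }

SN-efq : ∀ {t} → SN t → SN (efq t)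
SN-efq (sn h) = sn λ { (efq₁ st) → SN-efq (h st) ; (top ()) }

-- An elimination of an SN neutral term by SN arguments is SN: the neutral term can
-- never become the scrutinee of a redex, so the reduction happens in the pieces.
SN-app-ne : ∀ {a s} → Neutral a → SN a → SN s → SN (a · s)
SN-app-ne n (sn ha) (sn hs) = sn λ where
  (top β)  → ⊥-elim (neutral-value n v-lam)
  (·₁ st)  → SN-app-ne (neutral-⟶ n st) (ha st) (sn hs)
  (·₂ st)  → SN-app-ne n (sn ha) (hs st)

SN-π₁-ne : ∀ {a} → Neutral a → SN a → SN (π₁ a)
SN-π₁-ne n (sn ha) = sn λ where
  (top π₁β) → ⊥-elim (neutral-value n v-pair)
  (π₁₁ st)  → SN-π₁-ne (neutral-⟶ n st) (ha st)

SN-π₂-ne : ∀ {a} → Neutral a → SN a → SN (π₂ a)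
SN-π₂-ne n (sn ha) = sn λ where
  (top π₂β) → ⊥-elim (neutral-value n v-pair)
  (π₂₁ st)  → SN-π₂-ne (neutral-⟶ n st) (ha st)

SN-case-ne : ∀ {a s₁ s₂} → Neutral a → SN a → SN s₁ → SN s₂ → SN (case a s₁ s₂)
SN-case-ne n (sn ha) (sn h₁) (sn h₂) = sn λ where
  (top case₁)  → ⊥-elim (neutral-value n v-in₁)
  (top case₂)  → ⊥-elim (neutral-value n v-in₂)
  (case₁₁ st)  → SN-case-ne (neutral-⟶ n st) (ha st) (sn h₁) (sn h₂)
  (case₂₁ st)  → SN-case-ne n (sn ha) (h₁ st) (sn h₂)
  (case₃₁ st)  → SN-case-ne n (sn ha) (sn h₁) (h₂ st)

-- For hop the body must be variable-headed: hop with an efq-headed body is a redex.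
SN-hop-ne : ∀ {a s₁ s₂} → VarNe a → SN a → SN s₁ → SN s₂ → SN (hop a s₁ s₂)
SN-hop-ne n (sn ha) (sn h₁) (sn h₂) = sn λ where
  (top ρ)     → ⊥-elim (redex-scrutinee ρ (varNe-inert n))
  (hop₁₁ st)  → SN-hop-ne (varNe-⟶ n st) (ha st) (sn h₁) (sn h₂)
  (hop₂₁ st)  → SN-hop-ne n (sn ha) (h₁ st) (sn h₂)
  (hop₃₁ st)  → SN-hop-ne n (sn ha) (sn h₁) (h₂ st)

SN-varNe : ∀ {a} → VarNe a → SN a
SN-varNe var-ne              = SN-var
SN-varNe (app-ne n h)        = SN-app-ne (inj₁ n) (SN-varNe n) h
SN-varNe (π₁-ne n)           = SN-π₁-ne (inj₁ n) (SN-varNe n)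
SN-varNe (π₂-ne n)           = SN-π₂-ne (inj₁ n) (SN-varNe n)
SN-varNe (case-ne n h₁ h₂)   = SN-case-ne (inj₁ n) (SN-varNe n) h₁ h₂
SN-varNe (hop-ne n h₁ h₂)    = SN-hop-ne n (SN-varNe n) h₁ h₂

SN-efqNe : ∀ {t a} → EfqNe t a → SN a
SN-efqNe (efq-ne h)          = SN-efq h
SN-efqNe (app-ne e h)        = SN-app-ne (inj₂ (_ , e)) (SN-efqNe e) h
SN-efqNe (π₁-ne e)           = SN-π₁-ne (inj₂ (_ , e)) (SN-efqNe e)
SN-efqNe (π₂-ne e)           = SN-π₂-ne (inj₂ (_ , e)) (SN-efqNe e)
SN-efqNe (case-ne e h₁ h₂)   = SN-case-ne (inj₂ (_ , e)) (SN-efqNe e) h₁ h₂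

SN-neutral : ∀ {a} → Neutral a → SN a
SN-neutral (inj₁ n)       = SN-varNe n
SN-neutral (inj₂ (_ , e)) = SN-efqNe e

plugK-⟶ : ∀ K {r r'} → r ⟶ r' → plugK K r ⟶ plugK K r'
plugK-⟶ □             st = st
plugK-⟶ (K ·K _)      st = ·₁ (plugK-⟶ K st)
plugK-⟶ (π₁K K)       st = π₁₁ (plugK-⟶ K st)
plugK-⟶ (π₂K K)       st = π₂₁ (plugK-⟶ K st)
plugK-⟶ (caseK K _ _) st = case₁₁ (plugK-⟶ K st)
plugK-⟶ (hopK K _ _)  st = hop₁₁ (plugK-⟶ K st)

plugK-⟶* : ∀ K {r r'} → r ⟶* r' → plugK K r ⟶* plugK K r'
plugK-⟶* K = gmap (plugK K) (plugK-⟶ K)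

data KStep (K : KCtx) (r : Tm) : Tm → Set where
  inContext : ∀ K' → (∀ u → plugK K u ⟶ plugK K' u) → KStep K r (plugK K' r)
  inHole    : ∀ {r'} → r ⟶ r' → KStep K r (plugK K r')

-- For inert r no redex on the spine of K⟨r⟩ can be contracted, giving the dichotomy.
invK : ∀ K {r c} → Inert r → plugK K r ⟶ c → KStep K r c
invK □ i st = inHole st
invK (K ·K s) i (top ρ) = ⊥-elim (redex-scrutinee ρ (inert-plugK K i))
invK (K ·K s) i (·₁ st) with invK K i st
... | inContext K' f = inContext (K' ·K s) (λ u → ·₁ (f u))
... | inHole st'     = inHole st'
invK (K ·K s) i (·₂ st) = inContext (K ·K _) (λ u → ·₂ st)
invK (π₁K K) i (top ρ) = ⊥-elim (redex-scrutinee ρ (inert-plugK K i))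
invK (π₁K K) i (π₁₁ st) with invK K i st
... | inContext K' f = inContext (π₁K K') (λ u → π₁₁ (f u))
... | inHole st'     = inHole st'
invK (π₂K K) i (top ρ) = ⊥-elim (redex-scrutinee ρ (inert-plugK K i))
invK (π₂K K) i (π₂₁ st) with invK K i st
... | inContext K' f = inContext (π₂K K') (λ u → π₂₁ (f u))
... | inHole st'     = inHole st'
invK (caseK K s₁ s₂) i (top ρ) = ⊥-elim (redex-scrutinee ρ (inert-plugK K i))
invK (caseK K s₁ s₂) i (case₁₁ st) with invK K i st
... | inContext K' f = inContext (caseK K' s₁ s₂) (λ u → case₁₁ (f u))
... | inHole st'     = inHole st'
invK (caseK K s₁ s₂) i (case₂₁ st) = inContext (caseK K _ s₂) (λ u → case₂₁ st)
invK (caseK K s₁ s₂) i (case₃₁ st) = inContext (caseK K s₁ _) (λ u → case₃₁ st)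
invK (hopK K s₁ s₂) i (top ρ) = ⊥-elim (redex-scrutinee ρ (inert-plugK K i))
invK (hopK K s₁ s₂) i (hop₁₁ st) with invK K i st
... | inContext K' f = inContext (hopK K' s₁ s₂) (λ u → hop₁₁ (f u))
... | inHole st'     = inHole st'
invK (hopK K s₁ s₂) i (hop₂₁ st) = inContext (hopK K _ s₂) (λ u → hop₂₁ st)
invK (hopK K s₁ s₂) i (hop₃₁ st) = inContext (hopK K s₁ _) (λ u → hop₃₁ st)

-- Expansion r r': r is inert and each one-step reduct of r is either r' or again an
-- expansion of a reduct of r'.  Being inductive, it provides the measure for the
-- expansion lemma below.
data Expansion : Tm → Tm → Set where
  expansion : ∀ {r r'} → Inert r →
              (∀ {r₂} → r ⟶ r₂ → r₂ ≡ r' ⊎ ∃ λ r₂' → Expansion r₂ r₂' × r' ⟶* r₂') →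
              Expansion r r'

SN-expansion   : ∀ {r r'} → Expansion r r' → ∀ K → SN (plugK K r') → SN (plugK K r)
expansion-step : ∀ {r r' c} → Expansion r r' → ∀ K → SN (plugK K r') → KStep K r c → SN c
expansion-reduct : ∀ {r' r₂} K → SN (plugK K r') →
                   r₂ ≡ r' ⊎ (∃ λ r₂' → Expansion r₂ r₂' × r' ⟶* r₂') → SN (plugK K r₂)

SN-expansion ex@(expansion i _) K hk = sn λ st → expansion-step ex K hk (invK K i st)

expansion-step ex                  K (sn h) (inContext K' f) = SN-expansion ex K' (h (f _))
expansion-step (expansion _ next)  K hk     (inHole st)      = expansion-reduct K hk (next st)

expansion-reduct K hk (inj₁ refl)            = hk
expansion-reduct K hk (inj₂ (_ , ex' , red)) = SN-expansion ex' K (SN-⟶* hk (plugK-⟶* K red))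

data HopContraction (a s₁ s₂ : Tm) : Tm → Set where
  by-in₁ : ∀ {t} → a ≡ in₁ t → HopContraction a s₁ s₂ (s₁ [ lam t ])
  by-in₂ : ∀ {t} → a ≡ in₂ t → HopContraction a s₁ s₂ (s₂ [ lam t ])
  by-efq : ∀ {t} → efqHead a ≡ just t → HopContraction a s₁ s₂ (s₁ [ lam (efq t) ])

hop-contraction : ∀ {a s₁ s₂ c} → hop a s₁ s₂ ↦ c → HopContraction a s₁ s₂ c
hop-contraction hop₁             = by-in₁ refl
hop-contraction hop₂             = by-in₂ refl
hop-contraction (hopefq {W} {t}) = by-efq (efqHead-plugW W t)

in₁-contractum : ∀ {t s₁ s₂ c} → HopContraction (in₁ t) s₁ s₂ c → c ≡ s₁ [ lam t ]
in₁-contractum (by-in₁ refl) = refl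
in₁-contractum (by-efq ())

in₂-contractum : ∀ {t s₁ s₂ c} → HopContraction (in₂ t) s₁ s₂ c → c ≡ s₂ [ lam t ]
in₂-contractum (by-in₂ refl) = refl
in₂-contractum (by-efq ())

efq-contractum : ∀ {t a s₁ s₂ c} → EfqNe t a → HopContraction a s₁ s₂ c → c ≡ s₁ [ lam (efq t) ]
efq-contractum () (by-in₁ refl)
efq-contractum () (by-in₂ refl)
efq-contractum e  (by-efq h) with trans (sym (efqNe-head e)) h
... | refl = refl

β-expansion : ∀ {t s} → SN t → SN s → Expansion (lam t · s) (t [ s ])
β-expansion {t} {s} ht@(sn ht') hs@(sn hs') = expansion ((λ ()) , refl) λ where
  (top β)        → inj₁ refl
  (·₁ (lam₁ st)) → inj₂ (_ , β-expansion (ht' st) hs , []-⟶-body s st ◅ ε)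
  (·₁ (top ()))
  (·₂ st)        → inj₂ (_ , β-expansion ht (hs' st) , []-⟶-arg t st)

π₁β-expansion : ∀ {t₁ t₂} → SN t₁ → SN t₂ → Expansion (π₁ ⟨ t₁ , t₂ ⟩) t₁
π₁β-expansion h₁@(sn h₁') h₂@(sn h₂') = expansion ((λ ()) , refl) λ where
  (top π₁β)        → inj₁ refl
  (π₁₁ (pair₁ st)) → inj₂ (_ , π₁β-expansion (h₁' st) h₂ , st ◅ ε)
  (π₁₁ (pair₂ st)) → inj₂ (_ , π₁β-expansion h₁ (h₂' st) , ε)
  (π₁₁ (top ()))

π₂β-expansion : ∀ {t₁ t₂} → SN t₁ → SN t₂ → Expansion (π₂ ⟨ t₁ , t₂ ⟩) t₂
π₂β-expansion h₁@(sn h₁') h₂@(sn h₂') = expansion ((λ ()) , refl) λ where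
  (top π₂β)        → inj₁ refl
  (π₂₁ (pair₁ st)) → inj₂ (_ , π₂β-expansion (h₁' st) h₂ , ε)
  (π₂₁ (pair₂ st)) → inj₂ (_ , π₂β-expansion h₁ (h₂' st) , st ◅ ε)
  (π₂₁ (top ()))

case₁-expansion : ∀ {t s₁ s₂} → SN t → SN s₁ → SN s₂ → Expansion (case (in₁ t) s₁ s₂) (s₁ [ t ])
case₁-expansion {t} {s₁} {s₂} ht@(sn ht') h₁@(sn h₁') h₂@(sn h₂') = expansion ((λ ()) , refl) λ where
  (top case₁)        → inj₁ refl
  (case₁₁ (in₁₁ st)) → inj₂ (_ , case₁-expansion (ht' st) h₁ h₂ , []-⟶-arg s₁ st)
  (case₁₁ (top ()))
  (case₂₁ st)        → inj₂ (_ , case₁-expansion ht (h₁' st) h₂ , []-⟶-body t st ◅ ε)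
  (case₃₁ st)        → inj₂ (_ , case₁-expansion ht h₁ (h₂' st) , ε)

case₂-expansion : ∀ {t s₁ s₂} → SN t → SN s₁ → SN s₂ → Expansion (case (in₂ t) s₁ s₂) (s₂ [ t ])
case₂-expansion {t} {s₁} {s₂} ht@(sn ht') h₁@(sn h₁') h₂@(sn h₂') = expansion ((λ ()) , refl) λ where
  (top case₂)        → inj₁ refl
  (case₁₁ (in₂₁ st)) → inj₂ (_ , case₂-expansion (ht' st) h₁ h₂ , []-⟶-arg s₂ st)
  (case₁₁ (top ()))
  (case₂₁ st)        → inj₂ (_ , case₂-expansion ht (h₁' st) h₂ , ε)
  (case₃₁ st)        → inj₂ (_ , case₂-expansion ht h₁ (h₂' st) , []-⟶-body t st ◅ ε)

hop₁-expansion : ∀ {t s₁ s₂} → SN t → SN s₁ → SN s₂ → Expansion (hop (in₁ t) s₁ s₂) (s₁ [ lam t ])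
hop₁-expansion {t} {s₁} {s₂} ht@(sn ht') h₁@(sn h₁') h₂@(sn h₂') = expansion ((λ ()) , refl) λ where
  (top ρ)           → inj₁ (in₁-contractum (hop-contraction ρ))
  (hop₁₁ (in₁₁ st)) → inj₂ (_ , hop₁-expansion (ht' st) h₁ h₂ , []-⟶-arg s₁ (lam₁ st))
  (hop₁₁ (top ()))
  (hop₂₁ st)        → inj₂ (_ , hop₁-expansion ht (h₁' st) h₂ , []-⟶-body (lam t) st ◅ ε)
  (hop₃₁ st)        → inj₂ (_ , hop₁-expansion ht h₁ (h₂' st) , ε)

hop₂-expansion : ∀ {t s₁ s₂} → SN t → SN s₁ → SN s₂ → Expansion (hop (in₂ t) s₁ s₂) (s₂ [ lam t ])
hop₂-expansion {t} {s₁} {s₂} ht@(sn ht') h₁@(sn h₁') h₂@(sn h₂') = expansion ((λ ()) , refl) λ where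
  (top ρ)           → inj₁ (in₂-contractum (hop-contraction ρ))
  (hop₁₁ (in₂₁ st)) → inj₂ (_ , hop₂-expansion (ht' st) h₁ h₂ , []-⟶-arg s₂ (lam₁ st))
  (hop₁₁ (top ()))
  (hop₂₁ st)        → inj₂ (_ , hop₂-expansion ht (h₁' st) h₂ , ε)
  (hop₃₁ st)        → inj₂ (_ , hop₂-expansion ht h₁ (h₂' st) , []-⟶-body (lam t) st ◅ ε)

-- Here the measure is SN of the whole body a = W⟨efq t⟩.
hopefq-expansion : ∀ {t a s₁ s₂} → EfqNe t a → SN a → SN s₁ → SN s₂ →
                   Expansion (hop a s₁ s₂) (s₁ [ lam (efq t) ])
hopefq-expansion {t} {a} {s₁} {s₂} e ha@(sn ha') h₁@(sn h₁') h₂@(sn h₂') =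
  expansion ((λ ()) , refl) λ where
  (top ρ)     → inj₁ (efq-contractum e (hop-contraction ρ))
  (hop₁₁ st)  → let _ , e' , red = efqNe-⟶ e st in
                inj₂ (_ , hopefq-expansion e' (ha' st) h₁ h₂ ,
                      []-⟶*-arg s₁ (gmap (λ u → lam (efq u)) (λ r → lam₁ (efq₁ r)) red))
  (hop₂₁ st)  → inj₂ (_ , hopefq-expansion e ha (h₁' st) h₂ , []-⟶-body (lam (efq t)) st ◅ ε)
  (hop₃₁ st)  → inj₂ (_ , hopefq-expansion e ha h₁ (h₂' st) , ε)

↦SN-expansion : ∀ {r r'} → r ↦SN r' → Expansion r r'
↦SN-expansion (β ht hs)           = β-expansion ht hs
↦SN-expansion (π₁β h₁ h₂)         = π₁β-expansion h₁ h₂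
↦SN-expansion (π₂β h₁ h₂)         = π₂β-expansion h₁ h₂
↦SN-expansion (case₁ ht h₁ h₂)    = case₁-expansion ht h₁ h₂
↦SN-expansion (case₂ ht h₁ h₂)    = case₂-expansion ht h₁ h₂
↦SN-expansion (hop₁ ht h₁ h₂)     = hop₁-expansion ht h₁ h₂
↦SN-expansion (hop₂ ht h₁ h₂)     = hop₂-expansion ht h₁ h₂
↦SN-expansion (hopefq {W} w ht h₁ h₂) = hopefq-expansion e (SN-efqNe e) h₁ h₂
  where e = efqNe-plugW W w ht

_→SN*_ : Tm → Tm → Set
_→SN*_ = Star _→SN_

infix 4 _→SN*_

SN-backward : ∀ {a b} → a →SN b → SN b → SN a
SN-backward (step K _ ρ) = SN-expansion (↦SN-expansion ρ) K

SN-backward* : ∀ {a b} → a →SN* b → SN b → SN a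
SN-backward* ε          h = h
SN-backward* (st ◅ sts) h = SN-backward st (SN-backward* sts h)

infix 4 _⇝_

data _⇝_ : Tm → Tm → Set where
  β      : ∀ {t s} → SN t → SN s → lam t · s ⇝ t [ s ]
  π₁β    : ∀ {t₁ t₂} → SN t₁ → SN t₂ → π₁ ⟨ t₁ , t₂ ⟩ ⇝ t₁
  π₂β    : ∀ {t₁ t₂} → SN t₁ → SN t₂ → π₂ ⟨ t₁ , t₂ ⟩ ⇝ t₂
  case₁  : ∀ {t s₁ s₂} → SN t → SN s₁ → SN s₂ → case (in₁ t) s₁ s₂ ⇝ s₁ [ t ]
  case₂  : ∀ {t s₁ s₂} → SN t → SN s₁ → SN s₂ → case (in₂ t) s₁ s₂ ⇝ s₂ [ t ]
  hop₁   : ∀ {t s₁ s₂} → SN t → SN s₁ → SN s₂ → hop (in₁ t) s₁ s₂ ⇝ s₁ [ lam t ]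
  hop₂   : ∀ {t s₁ s₂} → SN t → SN s₁ → SN s₂ → hop (in₂ t) s₁ s₂ ⇝ s₂ [ lam t ]
  hopefq : ∀ {t a s₁ s₂} → EfqNe t a → SN s₁ → SN s₂ → hop a s₁ s₂ ⇝ s₁ [ lam (efq t) ]
  ξ·     : ∀ {a b s} → a ⇝ b → SN s → a · s ⇝ b · s
  ξπ₁    : ∀ {a b} → a ⇝ b → π₁ a ⇝ π₁ b
  ξπ₂    : ∀ {a b} → a ⇝ b → π₂ a ⇝ π₂ b
  ξcase  : ∀ {a b s₁ s₂} → a ⇝ b → SN s₁ → SN s₂ → case a s₁ s₂ ⇝ case b s₁ s₂
  ξhop   : ∀ {a b s₁ s₂} → a ⇝ b → SN s₁ → SN s₂ → hop a s₁ s₂ ⇝ hop b s₁ s₂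

contraction-⇝ : ∀ {r r'} → r ↦SN r' → r ⇝ r'
contraction-⇝ (β ht hs)               = β ht hs
contraction-⇝ (π₁β h₁ h₂)             = π₁β h₁ h₂
contraction-⇝ (π₂β h₁ h₂)             = π₂β h₁ h₂
contraction-⇝ (case₁ ht h₁ h₂)        = case₁ ht h₁ h₂
contraction-⇝ (case₂ ht h₁ h₂)        = case₂ ht h₁ h₂
contraction-⇝ (hop₁ ht h₁ h₂)         = hop₁ ht h₁ h₂
contraction-⇝ (hop₂ ht h₁ h₂)         = hop₂ ht h₁ h₂
contraction-⇝ (hopefq {W} w ht h₁ h₂) = hopefq (efqNe-plugW W w ht) h₁ h₂

plugK-⇝ : ∀ K {r r'} → SNK K → r ⇝ r' → plugK K r ⇝ plugK K r'
plugK-⇝ □             _             st = st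
plugK-⇝ (K ·K _)      (k , h)       st = ξ· (plugK-⇝ K k st) h
plugK-⇝ (π₁K K)       k             st = ξπ₁ (plugK-⇝ K k st)
plugK-⇝ (π₂K K)       k             st = ξπ₂ (plugK-⇝ K k st)
plugK-⇝ (caseK K _ _) (k , h₁ , h₂) st = ξcase (plugK-⇝ K k st) h₁ h₂
plugK-⇝ (hopK K _ _)  (k , h₁ , h₂) st = ξhop (plugK-⇝ K k st) h₁ h₂

→SN⇒⇝ : ∀ {a b} → a →SN b → a ⇝ b
→SN⇒⇝ (step K k ρ) = plugK-⇝ K k (contraction-⇝ ρ)

→SN-app : ∀ {a b s} → a →SN b → SN s → (a · s) →SN (b · s)
→SN-app (step K k ρ) h = step (K ·K _) (k , h) ρ

→SN-π₁ : ∀ {a b} → a →SN b → π₁ a →SN π₁ b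
→SN-π₁ (step K k ρ) = step (π₁K K) k ρ

→SN-π₂ : ∀ {a b} → a →SN b → π₂ a →SN π₂ b
→SN-π₂ (step K k ρ) = step (π₂K K) k ρ

→SN-case : ∀ {a b s₁ s₂} → a →SN b → SN s₁ → SN s₂ → case a s₁ s₂ →SN case b s₁ s₂
→SN-case (step K k ρ) h₁ h₂ = step (caseK K _ _) (k , h₁ , h₂) ρ

→SN-hop : ∀ {a b s₁ s₂} → a →SN b → SN s₁ → SN s₂ → hop a s₁ s₂ →SN hop b s₁ s₂
→SN-hop (step K k ρ) h₁ h₂ = step (hopK K _ _) (k , h₁ , h₂) ρ

→SN*-app : ∀ {a b s} → a →SN* b → SN s → (a · s) →SN* (b · s)
→SN*-app red h = gmap (_· _) (λ st → →SN-app st h) red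

→SN*-π₁ : ∀ {a b} → a →SN* b → π₁ a →SN* π₁ b
→SN*-π₁ = gmap π₁ →SN-π₁

→SN*-π₂ : ∀ {a b} → a →SN* b → π₂ a →SN* π₂ b
→SN*-π₂ = gmap π₂ →SN-π₂

→SN*-case : ∀ {a b s₁ s₂} → a →SN* b → SN s₁ → SN s₂ → case a s₁ s₂ →SN* case b s₁ s₂
→SN*-case red h₁ h₂ = gmap (λ u → case u _ _) (λ st → →SN-case st h₁ h₂) red

→SN*-hop : ∀ {a b s₁ s₂} → a →SN* b → SN s₁ → SN s₂ → hop a s₁ s₂ →SN* hop b s₁ s₂
→SN*-hop red h₁ h₂ = gmap (λ u → hop u _ _) (λ st → →SN-hop st h₁ h₂) red

⇝⇒→SN : ∀ {a b} → a ⇝ b → a →SN b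
⇝⇒→SN (β ht hs)           = step □ tt (β ht hs)
⇝⇒→SN (π₁β h₁ h₂)         = step □ tt (π₁β h₁ h₂)
⇝⇒→SN (π₂β h₁ h₂)         = step □ tt (π₂β h₁ h₂)
⇝⇒→SN (case₁ ht h₁ h₂)    = step □ tt (case₁ ht h₁ h₂)
⇝⇒→SN (case₂ ht h₁ h₂)    = step □ tt (case₂ ht h₁ h₂)
⇝⇒→SN (hop₁ ht h₁ h₂)     = step □ tt (hop₁ ht h₁ h₂)
⇝⇒→SN (hop₂ ht h₁ h₂)     = step □ tt (hop₂ ht h₁ h₂)
⇝⇒→SN (hopefq e h₁ h₂) with efqNe-context e
... | W , w , refl = step □ tt (hopefq w (efqNe-SN e) h₁ h₂)
⇝⇒→SN (ξ· st h)           = →SN-app (⇝⇒→SN st) h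
⇝⇒→SN (ξπ₁ st)            = →SN-π₁ (⇝⇒→SN st)
⇝⇒→SN (ξπ₂ st)            = →SN-π₂ (⇝⇒→SN st)
⇝⇒→SN (ξcase st h₁ h₂)    = →SN-case (⇝⇒→SN st) h₁ h₂
⇝⇒→SN (ξhop st h₁ h₂)     = →SN-hop (⇝⇒→SN st) h₁ h₂

value-⇝ : ∀ {v c} → Value v → v ⇝ c → ⊥
value-⇝ v-lam  ()
value-⇝ v-pair ()
value-⇝ v-in₁  ()
value-⇝ v-in₂  ()

varNe-efqNe : ∀ {t a} → VarNe a → EfqNe t a → ⊥
varNe-efqNe (app-ne n _)    (app-ne e _)    = varNe-efqNe n e
varNe-efqNe (π₁-ne n)       (π₁-ne e)       = varNe-efqNe n e
varNe-efqNe (π₂-ne n)       (π₂-ne e)       = varNe-efqNe n e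
varNe-efqNe (case-ne n _ _) (case-ne e _ _) = varNe-efqNe n e

varNe-⇝ : ∀ {a c} → VarNe a → a ⇝ c → ⊥
varNe-⇝ (app-ne () _)      (β _ _)
varNe-⇝ (app-ne n _)       (ξ· st _)      = varNe-⇝ n st
varNe-⇝ (π₁-ne ())         (π₁β _ _)
varNe-⇝ (π₁-ne n)          (ξπ₁ st)       = varNe-⇝ n st
varNe-⇝ (π₂-ne ())         (π₂β _ _)
varNe-⇝ (π₂-ne n)          (ξπ₂ st)       = varNe-⇝ n st
varNe-⇝ (case-ne () _ _)   (case₁ _ _ _)
varNe-⇝ (case-ne () _ _)   (case₂ _ _ _)
varNe-⇝ (case-ne n _ _)    (ξcase st _ _) = varNe-⇝ n st
varNe-⇝ (hop-ne () _ _)    (hop₁ _ _ _)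
varNe-⇝ (hop-ne () _ _)    (hop₂ _ _ _)
varNe-⇝ (hop-ne n _ _)     (hopefq e _ _) = varNe-efqNe n e
varNe-⇝ (hop-ne n _ _)     (ξhop st _ _)  = varNe-⇝ n st

efqNe-⇝ : ∀ {t a c} → EfqNe t a → a ⇝ c → ⊥
efqNe-⇝ (app-ne () _)      (β _ _)
efqNe-⇝ (app-ne e _)       (ξ· st _)      = efqNe-⇝ e st
efqNe-⇝ (π₁-ne ())         (π₁β _ _)
efqNe-⇝ (π₁-ne e)          (ξπ₁ st)       = efqNe-⇝ e st
efqNe-⇝ (π₂-ne ())         (π₂β _ _)
efqNe-⇝ (π₂-ne e)          (ξπ₂ st)       = efqNe-⇝ e st
efqNe-⇝ (case-ne () _ _)   (case₁ _ _ _)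
efqNe-⇝ (case-ne () _ _)   (case₂ _ _ _)
efqNe-⇝ (case-ne e _ _)    (ξcase st _ _) = efqNe-⇝ e st

value-normal : ∀ {v} → Value v → SNNormal v
value-normal v (_ , st) = value-⇝ v (→SN⇒⇝ st)

neutral-normal : ∀ {a} → Neutral a → SNNormal a
neutral-normal (inj₁ n)       (_ , st) = varNe-⇝ n (→SN⇒⇝ st)
neutral-normal (inj₂ (_ , e)) (_ , st) = efqNe-⇝ e (→SN⇒⇝ st)

-- ⇝ is deterministic: redexes do not overlap, and the scrutinee of a redex is a value or
-- an efq-headed term, neither of which steps.
⇝-deterministic : ∀ {a b c} → a ⇝ b → a ⇝ c → b ≡ c
⇝-deterministic (β _ _)          (β _ _)          = refl
⇝-deterministic (β _ _)          (ξ· () _)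
⇝-deterministic (π₁β _ _)        (π₁β _ _)        = refl
⇝-deterministic (π₁β _ _)        (ξπ₁ ())
⇝-deterministic (π₂β _ _)        (π₂β _ _)        = refl
⇝-deterministic (π₂β _ _)        (ξπ₂ ())
⇝-deterministic (case₁ _ _ _)    (case₁ _ _ _)    = refl
⇝-deterministic (case₁ _ _ _)    (ξcase () _ _)
⇝-deterministic (case₂ _ _ _)    (case₂ _ _ _)    = refl
⇝-deterministic (case₂ _ _ _)    (ξcase () _ _)
⇝-deterministic (hop₁ _ _ _)     (hop₁ _ _ _)     = refl
⇝-deterministic (hop₁ _ _ _)     (hopefq () _ _)
⇝-deterministic (hop₁ _ _ _)     (ξhop () _ _)
⇝-deterministic (hop₂ _ _ _)     (hop₂ _ _ _)     = refl
⇝-deterministic (hop₂ _ _ _)     (hopefq () _ _)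
⇝-deterministic (hop₂ _ _ _)     (ξhop () _ _)
⇝-deterministic (hopefq () _ _)  (hop₁ _ _ _)
⇝-deterministic (hopefq () _ _)  (hop₂ _ _ _)
⇝-deterministic (hopefq e _ _)   (hopefq e' _ _)
  with just-injective (trans (sym (efqNe-head e)) (efqNe-head e'))
... | refl = refl
⇝-deterministic (hopefq e _ _)   (ξhop st _ _)    = ⊥-elim (efqNe-⇝ e st)
⇝-deterministic (ξ· () _)        (β _ _)
⇝-deterministic (ξ· st _)        (ξ· st' _)       = cong (_· _) (⇝-deterministic st st')
⇝-deterministic (ξπ₁ ())         (π₁β _ _)
⇝-deterministic (ξπ₁ st)         (ξπ₁ st')        = cong π₁ (⇝-deterministic st st')
⇝-deterministic (ξπ₂ ())         (π₂β _ _)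
⇝-deterministic (ξπ₂ st)         (ξπ₂ st')        = cong π₂ (⇝-deterministic st st')
⇝-deterministic (ξcase () _ _)   (case₁ _ _ _)
⇝-deterministic (ξcase () _ _)   (case₂ _ _ _)
⇝-deterministic (ξcase st _ _)   (ξcase st' _ _)  = cong (λ u → case u _ _) (⇝-deterministic st st')
⇝-deterministic (ξhop () _ _)    (hop₁ _ _ _)
⇝-deterministic (ξhop () _ _)    (hop₂ _ _ _)
⇝-deterministic (ξhop st _ _)    (hopefq e _ _)   = ⊥-elim (efqNe-⇝ e st)
⇝-deterministic (ξhop st _ _)    (ξhop st' _ _)   = cong (λ u → hop u _ _) (⇝-deterministic st st')

→SN*-deterministic : ∀ {a b c} → a →SN* b → a →SN* c → SNNormal b → SNNormal c → b ≡ c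
→SN*-deterministic ε          ε          _  _  = refl
→SN*-deterministic ε          (st ◅ _)   nb _  = ⊥-elim (nb (_ , st))
→SN*-deterministic (st ◅ _)   ε          _  nc = ⊥-elim (nc (_ , st))
→SN*-deterministic (st ◅ sts) (st' ◅ sts') nb nc
  with ⇝-deterministic (→SN⇒⇝ st) (→SN⇒⇝ st')
... | refl = →SN*-deterministic sts sts' nb nc

⇝-target : ∀ {a b c} → b ≡ c → a ⇝ b → a ⇝ c
⇝-target refl st = st

sub-efqNe : ∀ τ {t a} → SN (sub τ a) → EfqNe t a → EfqNe (sub τ t) (sub τ a)
sub-efqNe τ h (efq-ne _)      = efq-ne (SN-inv efq efq₁ h)
sub-efqNe τ h (app-ne e _)    = let ha , hs = SN-app-parts h in app-ne (sub-efqNe τ ha e) hs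
sub-efqNe τ h (π₁-ne e)       = π₁-ne (sub-efqNe τ (SN-inv π₁ π₁₁ h) e)
sub-efqNe τ h (π₂-ne e)       = π₂-ne (sub-efqNe τ (SN-inv π₂ π₂₁ h) e)
sub-efqNe τ h (case-ne e _ _) = let ha , h₁ , h₂ = SN-case-parts h in case-ne (sub-efqNe τ ha e) h₁ h₂

-- The SN side conditions of the substituted step come from SN of the substituted term.
sub-⇝ : ∀ τ {a b} → SN (sub τ a) → a ⇝ b → sub τ a ⇝ sub τ b
sub-⇝ τ h (β {t} {s} _ _) =
  let hf , hs = SN-app-parts h in ⇝-target (sym (sub-[] τ t s)) (β (SN-inv lam lam₁ hf) hs)
sub-⇝ τ h (π₁β _ _) = let h₀ = SN-inv π₁ π₁₁ h in π₁β (SN-inv ⟨_, _ ⟩ pair₁ h₀) (SN-inv ⟨ _ ,_⟩ pair₂ h₀)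
sub-⇝ τ h (π₂β _ _) = let h₀ = SN-inv π₂ π₂₁ h in π₂β (SN-inv ⟨_, _ ⟩ pair₁ h₀) (SN-inv ⟨ _ ,_⟩ pair₂ h₀)
sub-⇝ τ h (case₁ {t} {s₁} _ _ _) =
  let ha , h₁ , h₂ = SN-case-parts h in ⇝-target (sym (sub-[] τ s₁ t)) (case₁ (SN-inv in₁ in₁₁ ha) h₁ h₂)
sub-⇝ τ h (case₂ {t} {s₂ = s₂} _ _ _) =
  let ha , h₁ , h₂ = SN-case-parts h in ⇝-target (sym (sub-[] τ s₂ t)) (case₂ (SN-inv in₂ in₂₁ ha) h₁ h₂)
sub-⇝ τ h (hop₁ {t} {s₁} _ _ _) =
  let ha , h₁ , h₂ = SN-hop-parts h in ⇝-target (sym (sub-[] τ s₁ (lam t))) (hop₁ (SN-inv in₁ in₁₁ ha) h₁ h₂)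
sub-⇝ τ h (hop₂ {t} {s₂ = s₂} _ _ _) =
  let ha , h₁ , h₂ = SN-hop-parts h in ⇝-target (sym (sub-[] τ s₂ (lam t))) (hop₂ (SN-inv in₂ in₂₁ ha) h₁ h₂)
sub-⇝ τ h (hopefq {t} {s₁ = s₁} e _ _) =
  let ha , h₁ , h₂ = SN-hop-parts h in
  ⇝-target (sym (sub-[] τ s₁ (lam (efq t)))) (hopefq (sub-efqNe (exts τ) ha e) h₁ h₂)
sub-⇝ τ h (ξ· st _)      = let ha , hs = SN-app-parts h in ξ· (sub-⇝ τ ha st) hs
sub-⇝ τ h (ξπ₁ st)       = ξπ₁ (sub-⇝ τ (SN-inv π₁ π₁₁ h) st)
sub-⇝ τ h (ξπ₂ st)       = ξπ₂ (sub-⇝ τ (SN-inv π₂ π₂₁ h) st)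
sub-⇝ τ h (ξcase st _ _) = let ha , h₁ , h₂ = SN-case-parts h in ξcase (sub-⇝ τ ha st) h₁ h₂
sub-⇝ τ h (ξhop st _ _)  = let ha , h₁ , h₂ = SN-hop-parts h in ξhop (sub-⇝ (exts τ) ha st) h₁ h₂

contraction-↦ : ∀ {r r'} → r ↦SN r' → r ↦ r'
contraction-↦ (β _ _)            = β
contraction-↦ (π₁β _ _)          = π₁β
contraction-↦ (π₂β _ _)          = π₂β
contraction-↦ (case₁ _ _ _)      = case₁
contraction-↦ (case₂ _ _ _)      = case₂
contraction-↦ (hop₁ _ _ _)       = hop₁
contraction-↦ (hop₂ _ _ _)       = hop₂
contraction-↦ (hopefq _ _ _ _)   = hopefq

→SN-⟶ : ∀ {a b} → a →SN b → a ⟶ b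
→SN-⟶ (step K _ ρ) = plugK-⟶ K (top (contraction-↦ ρ))

→SN*-⟶* : ∀ {a b} → a →SN* b → a ⟶* b
→SN*-⟶* = gmap (λ a → a) →SN-⟶

sub-→SN* : ∀ τ {a b} → SN (sub τ a) → a →SN* b → sub τ a →SN* sub τ b
sub-→SN* τ h ε          = ε
sub-→SN* τ h (st ◅ sts) = st' ◅ sub-→SN* τ (SN-⟶ h (→SN-⟶ st')) sts
  where st' = ⇝⇒→SN (sub-⇝ τ h (→SN⇒⇝ st))

[]-→SN* : ∀ s {a b} → SN (a [ s ]) → a →SN* b → a [ s ] →SN* b [ s ]
[]-→SN* s {a} {b} h red =
  subst₂ _→SN*_ (sym ([]-def a s)) (sym ([]-def b s)) (sub-→SN* (s • var) (subst SN ([]-def a s) h) red)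

ren-efqNe : ∀ ρ a {t} → EfqNe t (rename ρ a) → ∃ λ t' → EfqNe t' a × rename ρ t' ≡ t
ren-efqNe ρ (efq b) (efq-ne h) = b , efq-ne (SN-ren ρ h) , refl
ren-efqNe ρ (a · s) (app-ne e h) =
  let t' , e' , eq = ren-efqNe ρ a e in t' , app-ne e' (SN-ren ρ h) , eq
ren-efqNe ρ (π₁ a) (π₁-ne e) = let t' , e' , eq = ren-efqNe ρ a e in t' , π₁-ne e' , eq
ren-efqNe ρ (π₂ a) (π₂-ne e) = let t' , e' , eq = ren-efqNe ρ a e in t' , π₂-ne e' , eq
ren-efqNe ρ (case a s₁ s₂) (case-ne e h₁ h₂) =
  let t' , e' , eq = ren-efqNe ρ a e in t' , case-ne e' (SN-ren (ext ρ) h₁) (SN-ren (ext ρ) h₂) , eq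

ren-varNe : ∀ ρ a → VarNe (rename ρ a) → VarNe a
ren-varNe ρ (var i)        var-ne            = var-ne
ren-varNe ρ (a · s)        (app-ne n h)      = app-ne (ren-varNe ρ a n) (SN-ren ρ h)
ren-varNe ρ (π₁ a)         (π₁-ne n)         = π₁-ne (ren-varNe ρ a n)
ren-varNe ρ (π₂ a)         (π₂-ne n)         = π₂-ne (ren-varNe ρ a n)
ren-varNe ρ (case a s₁ s₂) (case-ne n h₁ h₂) =
  case-ne (ren-varNe ρ a n) (SN-ren (ext ρ) h₁) (SN-ren (ext ρ) h₂)
ren-varNe ρ (hop a s₁ s₂)  (hop-ne n h₁ h₂) =
  hop-ne (ren-varNe (ext ρ) a n) (SN-ren (ext ρ) h₁) (SN-ren (ext ρ) h₂)

ren-⇝ : ∀ ρ a {c} → rename ρ a ⇝ c → ∃ λ a' → a ⇝ a' × rename ρ a' ≡ c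
ren-⇝ ρ (lam t · s) (β ht hs) = t [ s ] , β (SN-ren (ext ρ) ht) (SN-ren ρ hs) , ren-[] ρ t s
ren-⇝ ρ (π₁ ⟨ t₁ , t₂ ⟩) (π₁β h₁ h₂) = t₁ , π₁β (SN-ren ρ h₁) (SN-ren ρ h₂) , refl
ren-⇝ ρ (π₂ ⟨ t₁ , t₂ ⟩) (π₂β h₁ h₂) = t₂ , π₂β (SN-ren ρ h₁) (SN-ren ρ h₂) , refl
ren-⇝ ρ (case (in₁ t) s₁ s₂) (case₁ ht h₁ h₂) =
  s₁ [ t ] , case₁ (SN-ren ρ ht) (SN-ren (ext ρ) h₁) (SN-ren (ext ρ) h₂) , ren-[] ρ s₁ t
ren-⇝ ρ (case (in₂ t) s₁ s₂) (case₂ ht h₁ h₂) =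
  s₂ [ t ] , case₂ (SN-ren ρ ht) (SN-ren (ext ρ) h₁) (SN-ren (ext ρ) h₂) , ren-[] ρ s₂ t
ren-⇝ ρ (hop (in₁ t) s₁ s₂) (hop₁ ht h₁ h₂) =
  s₁ [ lam t ] , hop₁ (SN-ren (ext ρ) ht) (SN-ren (ext ρ) h₁) (SN-ren (ext ρ) h₂) , ren-[] ρ s₁ (lam t)
ren-⇝ ρ (hop (in₂ t) s₁ s₂) (hop₂ ht h₁ h₂) =
  s₂ [ lam t ] , hop₂ (SN-ren (ext ρ) ht) (SN-ren (ext ρ) h₁) (SN-ren (ext ρ) h₂) , ren-[] ρ s₂ (lam t)
ren-⇝ ρ (hop a s₁ s₂) (hopefq e h₁ h₂) with ren-efqNe (ext ρ) a e
... | t , e' , refl =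
  s₁ [ lam (efq t) ] , hopefq e' (SN-ren (ext ρ) h₁) (SN-ren (ext ρ) h₂) , ren-[] ρ s₁ (lam (efq t))
ren-⇝ ρ (a · s) (ξ· st h) with ren-⇝ ρ a st
... | a' , st' , refl = a' · s , ξ· st' (SN-ren ρ h) , refl
ren-⇝ ρ (π₁ a) (ξπ₁ st) with ren-⇝ ρ a st
... | a' , st' , refl = π₁ a' , ξπ₁ st' , refl
ren-⇝ ρ (π₂ a) (ξπ₂ st) with ren-⇝ ρ a st
... | a' , st' , refl = π₂ a' , ξπ₂ st' , refl
ren-⇝ ρ (case a s₁ s₂) (ξcase st h₁ h₂) with ren-⇝ ρ a st
... | a' , st' , refl = case a' s₁ s₂ , ξcase st' (SN-ren (ext ρ) h₁) (SN-ren (ext ρ) h₂) , refl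
ren-⇝ ρ (hop a s₁ s₂) (ξhop st h₁ h₂) with ren-⇝ (ext ρ) a st
... | a' , st' , refl = hop a' s₁ s₂ , ξhop st' (SN-ren (ext ρ) h₁) (SN-ren (ext ρ) h₂) , refl

ren-→SN* : ∀ ρ a {c} → rename ρ a →SN* c → ∃ λ a' → a →SN* a' × rename ρ a' ≡ c
ren-→SN* ρ a ε = a , ε , refl
ren-→SN* ρ a (st ◅ sts) with ren-⇝ ρ a (→SN⇒⇝ st)
... | a₁ , st₁ , refl = let a' , sts' , eq = ren-→SN* ρ a₁ sts in a' , ⇝⇒→SN st₁ ◅ sts' , eq

SN-lam : ∀ {t} → SN t → SN (lam t)
SN-lam (sn h) = sn λ { (lam₁ st) → SN-lam (h st) ; (top ()) }

SN-pair : ∀ {t s} → SN t → SN s → SN ⟨ t , s ⟩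
SN-pair (sn ht) (sn hs) = sn λ where
  (pair₁ st) → SN-pair (ht st) (sn hs)
  (pair₂ st) → SN-pair (sn ht) (hs st)
  (top ())

SN-in₁ : ∀ {t} → SN t → SN (in₁ t)
SN-in₁ (sn h) = sn λ { (in₁₁ st) → SN-in₁ (h st) ; (top ()) }

SN-in₂ : ∀ {t} → SN t → SN (in₂ t)
SN-in₂ (sn h) = sn λ { (in₂₁ st) → SN-in₂ (h st) ; (top ()) }

value-Bar : ∀ {T : Tm → Set} {v} → Value v → T v → Bar T v
value-Bar vv tv = _ , (ε , value-normal vv) , tv

Bar-backward : ∀ {T : Tm → Set} {a b} → a →SN* b → Bar T b → Bar T a
Bar-backward red (v , (red' , nf) , tv) = v , (red ◅◅ red' , nf) , tv

Bar-SN : ∀ {T : Tm → Set} → (∀ {v} → T v → SN v) → ∀ {a} → Bar T a → SN a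
Bar-SN T-SN (v , (red , _) , tv) = SN-backward* red (T-SN tv)

Body : Form → Form → Tm → Set
Body A B t = ∀ s → ⟦ A ⟧ s → ⟦ B ⟧ (t [ s ])

neutral-reducible : ∀ A {a} → Neutral a → ⟦ A ⟧ a
neutral-reducible (atom _) n = SN-neutral n
neutral-reducible ff       n = SN-neutral n
neutral-reducible (A ⇒ B)  n = inj₂ (_ , (ε , neutral-normal n) , neutral→Ne n)
neutral-reducible (A ∧ B)  n = inj₂ (_ , (ε , neutral-normal n) , neutral→Ne n)
neutral-reducible (A ∨ B)  n = inj₂ (_ , (ε , neutral-normal n) , neutral→Ne n)

var-reducible : ∀ A {x} → ⟦ A ⟧ (var x)
var-reducible A = neutral-reducible A (inj₁ var-ne)

reducible-backward : ∀ A {a b} → a →SN* b → ⟦ A ⟧ b → ⟦ A ⟧ a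
reducible-backward (atom _) red h = SN-backward* red h
reducible-backward ff       red h = SN-backward* red h
reducible-backward (A ⇒ B)  red (inj₁ h) = inj₁ (Bar-backward red h)
reducible-backward (A ⇒ B)  red (inj₂ h) = inj₂ (Bar-backward red h)
reducible-backward (A ∧ B)  red (inj₁ h) = inj₁ (Bar-backward red h)
reducible-backward (A ∧ B)  red (inj₂ h) = inj₂ (Bar-backward red h)
reducible-backward (A ∨ B)  red (inj₁ (inj₁ h)) = inj₁ (inj₁ (Bar-backward red h))
reducible-backward (A ∨ B)  red (inj₁ (inj₂ h)) = inj₁ (inj₂ (Bar-backward red h))
reducible-backward (A ∨ B)  red (inj₂ h) = inj₂ (Bar-backward red h)

Ne-SN : ∀ {a} → Ne a → SN a
Ne-SN ne = SN-neutral (Ne→neutral ne)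

reducible-SN : ∀ A {a} → ⟦ A ⟧ a → SN a
body-SN      : ∀ A B {t} → Body A B t → SN t

reducible-SN (atom _) h = h
reducible-SN ff       h = h
reducible-SN (A ⇒ B)  (inj₁ h) = Bar-SN (λ { (_ , refl , f) → SN-lam (body-SN A B f) }) h
reducible-SN (A ⇒ B)  (inj₂ h) = Bar-SN Ne-SN h
reducible-SN (A ∧ B)  (inj₁ h) =
  Bar-SN (λ { (_ , _ , refl , h₁ , h₂) → SN-pair (reducible-SN A h₁) (reducible-SN B h₂) }) h
reducible-SN (A ∧ B)  (inj₂ h) = Bar-SN Ne-SN h
reducible-SN (A ∨ B)  (inj₁ (inj₁ h)) = Bar-SN (λ { (_ , refl , h₁) → SN-in₁ (reducible-SN A h₁) }) h
reducible-SN (A ∨ B)  (inj₁ (inj₂ h)) = Bar-SN (λ { (_ , refl , h₂) → SN-in₂ (reducible-SN B h₂) }) h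
reducible-SN (A ∨ B)  (inj₂ h) = Bar-SN Ne-SN h

body-SN A B f = SN-[] (var 0) (reducible-SN B (f (var 0) (var-reducible A)))

-- For an elimination of a reducible term u,
-- u →SN-reduces either to an introduction form, and the elimination then makes one more
-- →SN step to a reducible term, or to a neutral term, and the elimination stays neutral.

lam-sem : ∀ {A B t} → Body A B t → ⟦ A ⇒ B ⟧ (lam t)
lam-sem f = inj₁ (value-Bar v-lam (_ , refl , f))

app-sem : ∀ {A B u s} → ⟦ A ⇒ B ⟧ u → ⟦ A ⟧ s → ⟦ B ⟧ (u · s)
app-sem {A} {B} {s = s} (inj₁ (_ , (red , _) , (t , refl , f))) hs =
  reducible-backward B (→SN*-app red hs' ◅◅ step □ tt (β (body-SN A B f) hs') ◅ ε) (f s hs)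
  where hs' = reducible-SN A hs
app-sem {A} {B} (inj₂ (_ , (red , _) , ne)) hs =
  reducible-backward B (→SN*-app red hs') (neutral-reducible B (neutral-app (Ne→neutral ne) hs'))
  where hs' = reducible-SN A hs

pair-sem : ∀ {A B t s} → ⟦ A ⟧ t → ⟦ B ⟧ s → ⟦ A ∧ B ⟧ ⟨ t , s ⟩
pair-sem ht hs = inj₁ (value-Bar v-pair (_ , _ , refl , ht , hs))

π₁-sem : ∀ {A B u} → ⟦ A ∧ B ⟧ u → ⟦ A ⟧ (π₁ u)
π₁-sem {A} {B} (inj₁ (_ , (red , _) , (_ , _ , refl , h₁ , h₂))) =
  reducible-backward A (→SN*-π₁ red ◅◅ step □ tt (π₁β (reducible-SN A h₁) (reducible-SN B h₂)) ◅ ε) h₁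
π₁-sem {A} (inj₂ (_ , (red , _) , ne)) =
  reducible-backward A (→SN*-π₁ red) (neutral-reducible A (neutral-π₁ (Ne→neutral ne)))

π₂-sem : ∀ {A B u} → ⟦ A ∧ B ⟧ u → ⟦ B ⟧ (π₂ u)
π₂-sem {A} {B} (inj₁ (_ , (red , _) , (_ , _ , refl , h₁ , h₂))) =
  reducible-backward B (→SN*-π₂ red ◅◅ step □ tt (π₂β (reducible-SN A h₁) (reducible-SN B h₂)) ◅ ε) h₂
π₂-sem {B = B} (inj₂ (_ , (red , _) , ne)) =
  reducible-backward B (→SN*-π₂ red) (neutral-reducible B (neutral-π₂ (Ne→neutral ne)))

in₁-sem : ∀ {A₁ A₂ t} → ⟦ A₁ ⟧ t → ⟦ A₁ ∨ A₂ ⟧ (in₁ t)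
in₁-sem h = inj₁ (inj₁ (value-Bar v-in₁ (_ , refl , h)))

in₂-sem : ∀ {A₁ A₂ t} → ⟦ A₂ ⟧ t → ⟦ A₁ ∨ A₂ ⟧ (in₂ t)
in₂-sem h = inj₁ (inj₂ (value-Bar v-in₂ (_ , refl , h)))

case-sem : ∀ {A₁ A₂ D u s₁ s₂} → ⟦ A₁ ∨ A₂ ⟧ u → Body A₁ D s₁ → Body A₂ D s₂ → ⟦ D ⟧ (case u s₁ s₂)
case-sem {A₁} {A₂} {D} hu f₁ f₂ = by-shape hu
  where
  h₁ = body-SN A₁ D f₁
  h₂ = body-SN A₂ D f₂
  by-shape : ∀ {u} → ⟦ A₁ ∨ A₂ ⟧ u → ⟦ D ⟧ (case u _ _)
  by-shape (inj₁ (inj₁ (_ , (red , _) , (t , refl , ht)))) =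
    reducible-backward D (→SN*-case red h₁ h₂ ◅◅ step □ tt (case₁ (reducible-SN A₁ ht) h₁ h₂) ◅ ε) (f₁ t ht)
  by-shape (inj₁ (inj₂ (_ , (red , _) , (t , refl , ht)))) =
    reducible-backward D (→SN*-case red h₁ h₂ ◅◅ step □ tt (case₂ (reducible-SN A₂ ht) h₁ h₂) ◅ ε) (f₂ t ht)
  by-shape (inj₂ (_ , (red , _) , ne)) =
    reducible-backward D (→SN*-case red h₁ h₂) (neutral-reducible D (neutral-case (Ne→neutral ne) h₁ h₂))

efq-sem : ∀ {A u} → SN u → ⟦ A ⟧ (efq u)
efq-sem {A} h = neutral-reducible A (inj₂ (_ , efq-ne h))

data ∨-Analysis (a : Tm) : Set where
  reduces-in₁   : ∀ {u} → a →SN* in₁ u → ∨-Analysis a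
  reduces-in₂   : ∀ {u} → a →SN* in₂ u → ∨-Analysis a
  reduces-varNe : ∀ {w} → a →SN* w → VarNe w → ∨-Analysis a
  reduces-efqNe : ∀ {w t} → a →SN* w → EfqNe t w → ∨-Analysis a

ren-in₁ : ∀ ρ a {u} → rename ρ a ≡ in₁ u → ∃ λ u' → a ≡ in₁ u'
ren-in₁ ρ (in₁ u) refl = u , refl

ren-in₂ : ∀ ρ a {u} → rename ρ a ≡ in₂ u → ∃ λ u' → a ≡ in₂ u'
ren-in₂ ρ (in₂ u) refl = u , refl

∨-analysis : ∀ A₁ A₂ ρ a → ⟦ A₁ ∨ A₂ ⟧ (rename ρ a) → ∨-Analysis a
∨-analysis A₁ A₂ ρ a (inj₁ (inj₁ (_ , (red , _) , (_ , refl , _)))) with ren-→SN* ρ a red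
... | a' , red' , eq with ren-in₁ ρ a' eq
...   | _ , refl = reduces-in₁ red'
∨-analysis A₁ A₂ ρ a (inj₁ (inj₂ (_ , (red , _) , (_ , refl , _)))) with ren-→SN* ρ a red
... | a' , red' , eq with ren-in₂ ρ a' eq
...   | _ , refl = reduces-in₂ red'
∨-analysis A₁ A₂ ρ a (inj₂ (_ , (red , _) , ne)) with ren-→SN* ρ a red
... | a' , red' , refl with Ne→neutral ne
...   | inj₁ n       = reduces-varNe red' (ren-varNe ρ a' n)
...   | inj₂ (_ , e) = reduces-efqNe red' (proj₁ (proj₂ (ren-efqNe ρ a' e)))

-- A closure, at a normal form the term reduces to, is its generating set (by determinism).
Bar-at : ∀ {T : Tm → Set} {a v} → Bar T a → a →SN* v → SNNormal v → T v
Bar-at (_ , (red , nf) , tw) red' nv with →SN*-deterministic red red' nf nv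
... | refl = tw

∨-at-in₁ : ∀ {A₁ A₂ a u} → ⟦ A₁ ∨ A₂ ⟧ a → a →SN* in₁ u → ⟦ A₁ ⟧ u
∨-at-in₁ (inj₁ (inj₁ h)) red with Bar-at h red (value-normal v-in₁)
... | _ , refl , hu = hu
∨-at-in₁ (inj₁ (inj₂ h)) red with Bar-at h red (value-normal v-in₁)
... | _ , () , _
∨-at-in₁ (inj₂ h)        red =
  ⊥-elim (neutral-value (Ne→neutral (Bar-at h red (value-normal v-in₁))) v-in₁)

∨-at-in₂ : ∀ {A₁ A₂ a u} → ⟦ A₁ ∨ A₂ ⟧ a → a →SN* in₂ u → ⟦ A₂ ⟧ u
∨-at-in₂ (inj₁ (inj₂ h)) red with Bar-at h red (value-normal v-in₂)
... | _ , refl , hu = hu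
∨-at-in₂ (inj₁ (inj₁ h)) red with Bar-at h red (value-normal v-in₂)
... | _ , () , _
∨-at-in₂ (inj₂ h)        red =
  ⊥-elim (neutral-value (Ne→neutral (Bar-at h red (value-normal v-in₂))) v-in₂)

efqNe-instance-SN : ∀ s {t a} → EfqNe t a → SN (a [ s ]) → SN (t [ s ])
efqNe-instance-SN s {t} {a} e h =
  subst SN (sym ([]-def t s)) (efqNe-SN (sub-efqNe (s • var) (subst SN ([]-def a s) h) e))

hop-sem : ∀ {B A₁ A₂ D t s₁ s₂} → Body (¬F B) (A₁ ∨ A₂) t →
          Body (¬F B ⇒ A₁) D s₁ → Body (¬F B ⇒ A₂) D s₂ → ⟦ D ⟧ (hop t s₁ s₂)
hop-sem {B} {A₁} {A₂} {D} {t} {s₁} {s₂} ft f₁ f₂ = by-analysis (∨-analysis A₁ A₂ contract t t₀)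
  where
  t₀ : ⟦ A₁ ∨ A₂ ⟧ (rename contract t)
  t₀ = subst ⟦ A₁ ∨ A₂ ⟧ ([var0] t) (ft (var 0) (var-reducible (¬F B)))

  h₁ = body-SN (¬F B ⇒ A₁) D f₁
  h₂ = body-SN (¬F B ⇒ A₂) D f₂
  ht = body-SN (¬F B) (A₁ ∨ A₂) ft

  instance-red : ∀ {w} → t →SN* w → ∀ s → ⟦ ¬F B ⟧ s → t [ s ] →SN* w [ s ]
  instance-red red s hs = []-→SN* s (reducible-SN (A₁ ∨ A₂) (ft s hs)) red

  by-analysis : ∨-Analysis t → ⟦ D ⟧ (hop t s₁ s₂)
  by-analysis (reduces-in₁ red) =
    reducible-backward D (→SN*-hop red h₁ h₂ ◅◅ step □ tt (hop₁ hu h₁ h₂) ◅ ε)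
      (f₁ _ (lam-sem {¬F B} λ s hs → ∨-at-in₁ (ft s hs) (instance-red red s hs)))
    where hu = SN-inv in₁ in₁₁ (SN-⟶* ht (→SN*-⟶* red))
  by-analysis (reduces-in₂ red) =
    reducible-backward D (→SN*-hop red h₁ h₂ ◅◅ step □ tt (hop₂ hu h₁ h₂) ◅ ε)
      (f₂ _ (lam-sem {¬F B} λ s hs → ∨-at-in₂ (ft s hs) (instance-red red s hs)))
    where hu = SN-inv in₂ in₂₁ (SN-⟶* ht (→SN*-⟶* red))
  by-analysis (reduces-varNe red n) =
    reducible-backward D (→SN*-hop red h₁ h₂) (neutral-reducible D (inj₁ (hop-ne n h₁ h₂)))
  by-analysis (reduces-efqNe red e) =
    reducible-backward D (→SN*-hop red h₁ h₂ ◅◅ ⇝⇒→SN (hopefq e h₁ h₂) ◅ ε)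
      (f₁ _ (lam-sem {¬F B} λ s hs → efq-sem (efqNe-instance-SN s e
        (SN-⟶* (reducible-SN (A₁ ∨ A₂) (ft s hs)) (→SN*-⟶* (instance-red red s hs))))))

extend-ctx : ∀ {Γ A σ s} → ⟦ A ⟧ s → ⟦ Γ ⟧ctx σ → ⟦ A ∷ Γ ⟧ctx (s • σ)
extend-ctx hs ρ here      = hs
extend-ctx hs ρ (there x) = ρ x

-- The body of a derivation d under a binder, substituted by σ, is a Body as soon as d is
-- sound for the instances s • σ; d itself only fixes the body and its formulas.
body-under : ∀ {Γ A B t} σ → (A ∷ Γ) ⊢ t ∶ B →
             (∀ s → ⟦ A ∷ Γ ⟧ctx (s • σ) → ⟦ B ⟧ (sub (s • σ) t)) →
             ⟦ Γ ⟧ctx σ → Body A B (sub (exts σ) t)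
body-under {B = B} {t} σ _ sound ρ s hs =
  subst ⟦ B ⟧ (sym (exts-[] σ t s)) (sound s (extend-ctx hs ρ))

mainTheorem14 : ∀ {Γ t A} (σ : Subst) → Γ ⊢ t ∶ A → ⟦ Γ ⟧ctx σ → ⟦ A ⟧ (sub σ t)
mainTheorem14 σ (ax x)           ρ = ρ x
mainTheorem14 σ (⇒I d)           ρ = lam-sem (body-under σ d (λ s → mainTheorem14 (s • σ) d) ρ)
mainTheorem14 σ (⇒E d e)         ρ = app-sem (mainTheorem14 σ d ρ) (mainTheorem14 σ e ρ)
mainTheorem14 σ (∧I d e)         ρ = pair-sem (mainTheorem14 σ d ρ) (mainTheorem14 σ e ρ)
mainTheorem14 σ (∧E₁ d)          ρ = π₁-sem (mainTheorem14 σ d ρ)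
mainTheorem14 σ (∧E₂ d)          ρ = π₂-sem (mainTheorem14 σ d ρ)
mainTheorem14 σ (∨I₁ d)          ρ = in₁-sem (mainTheorem14 σ d ρ)
mainTheorem14 σ (∨I₂ d)          ρ = in₂-sem (mainTheorem14 σ d ρ)
mainTheorem14 σ (∨E d d₁ d₂)     ρ =
  case-sem (mainTheorem14 σ d ρ) (body-under σ d₁ (λ s → mainTheorem14 (s • σ) d₁) ρ)
                                 (body-under σ d₂ (λ s → mainTheorem14 (s • σ) d₂) ρ)
mainTheorem14 {A = A} σ (⊥E d)   ρ = efq-sem {A} (mainTheorem14 σ d ρ)
mainTheorem14 σ (harrop {B = B} d d₁ d₂) ρ =
  hop-sem {B} (body-under σ d  (λ s → mainTheorem14 (s • σ) d)  ρ)
              (body-under σ d₁ (λ s → mainTheorem14 (s • σ) d₁) ρ)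
              (body-under σ d₂ (λ s → mainTheorem14 (s • σ) d₂) ρ)
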